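{- For every integer $k\ge 3$ there exists a $2$-edge-connected plane graph $G$ with exactly $4k$ edges such that $\chi_{fp}'(G)=12$.
   Context: All graphs are finite, planar, with a fixed plane embedding. An edge-coloring of a plane graph $G$ is a map $E(G)\to\mathbb{N}$. It is facially-proper if for every face $\alpha$, any two edges that appear consecutively on the boundary walk of $\alpha$ receive distinct colors. A facial-parity edge-coloring of a $2$-edge-connected plane graph $G$ is a facially-proper edge-coloring such that for every face $\alpha$ and every color $c$, the number of edges incident with $\alpha$ having color $c$ is either zero or odd. $\chi_{fp}'(G)$ denotes the minimum number of colors in a facial-parity edge-coloring of $G$. -}

module Defs where

-- Plane graphs are represented as combinatorial maps (rotation systems):
-- edges are Fin m, each edge e has two darts (e , false) and (e , true);
-- α flips the dart of an edge, σ is the rotation (a permutation of darts)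
-- giving the cyclic order of darts around each vertex.  Vertices are the
-- σ-orbits, faces are the orbits of φ = σ ∘ α (the facial boundary walks).
-- The map is a plane (genus 0) embedding iff it is connected and
-- V - E + F = 2 (Euler's formula).

open import Data.Nat using (ℕ; zero; suc; _+_; _*_; _≤_; _≤?_; _%_)
open import Data.Nat.Properties using () renaming (_≟_ to _≟ℕ_)
open import Data.Bool using (Bool; true; false; not)
open import Data.Bool.Properties using () renaming (_≟_ to _≟B_)
open import Data.Fin using (Fin; toℕ)
open import Data.Fin.Properties using (all?; any?) renaming (_≟_ to _≟F_)
open import Data.Product using (Σ; _×_; _,_; proj₁; ∃)
open import Data.Product.Properties using (≡-dec)
open import Data.Sum using (_⊎_)
open import Data.Unit using (⊤)
open import Data.List using (List; []; _∷_; length; filter; map; concatMap; deduplicate; allFin)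
open import Relation.Binary.PropositionalEquality using (_≡_; _≢_)
open import Relation.Binary.Construct.Closure.ReflexiveTransitive using (Star)
open import Relation.Nullary using (Dec; ¬_)
open import Relation.Nullary.Decidable using (_×-dec_; _⊎-dec_)

Dart : ℕ → Set
Dart m = Fin m × Bool

_≟D_ : ∀ {m} (d d' : Dart m) → Dec (d ≡ d')
_≟D_ = ≡-dec _≟F_ _≟B_

edge : ∀ {m} → Dart m → Fin m
edge = proj₁

α : ∀ {m} → Dart m → Dart m
α (e , b) = (e , not b)

darts : (m : ℕ) → List (Dart m)
darts m = concatMap (λ e → (e , false) ∷ (e , true) ∷ []) (allFin m)

idx : ∀ {m} → Dart m → ℕ
idx {m} (e , false) = toℕ e
idx {m} (e , true)  = m + toℕ e

iter : ∀ {A : Set} → (A → A) → ℕ → A → A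
iter f zero x = x
iter f (suc n) x = f (iter f n x)

record Map (m : ℕ) : Set where
  field
    σ    : Dart m → Dart m
    σ⁻   : Dart m → Dart m
    σσ⁻  : ∀ d → σ (σ⁻ d) ≡ d
    σ⁻σ  : ∀ d → σ⁻ (σ d) ≡ d

  φ : Dart m → Dart m
  φ d = σ (α d)

  -- d' lies in the orbit of d under π (orbits have length ≤ 2m)
  InOrbit : (Dart m → Dart m) → Dart m → Dart m → Set
  InOrbit π d d' = Σ (Fin (m + m)) λ i → iter π (toℕ i) d ≡ d'

  IsRep : (Dart m → Dart m) → Dart m → Set
  IsRep π d = ∀ (i : Fin (m + m)) → idx d ≤ idx (iter π (toℕ i) d)

  isRep? : (π : Dart m → Dart m) → (d : Dart m) → Dec (IsRep π d)
  isRep? π d = all? (λ i → idx d ≤? idx (iter π (toℕ i) d))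

  orbits : (Dart m → Dart m) → ℕ
  orbits π = length (filter (isRep? π) (darts m))

  numVertices : ℕ
  numVertices = orbits σ

  numFaces : ℕ
  numFaces = orbits φ

  data Step (P : Fin m → Set) : Dart m → Dart m → Set where
    around : ∀ d → Step P d (σ d)
    along  : ∀ d → P (edge d) → Step P d (α d)

  Connected : Set
  Connected = ∀ d d' → Star (Step (λ _ → ⊤)) d d'

  ConnectedWithout : Fin m → Set
  ConnectedWithout e = ∀ d d' → Star (Step (λ f → f ≢ e)) d d'

  TwoEdgeConnected : Set
  TwoEdgeConnected = Connected × (∀ e → ConnectedWithout e)

  IsPlane : Set
  IsPlane = Connected × (numVertices + numFaces ≡ m + 2)

  FaciallyProper : (Fin m → ℕ) → Set
  FaciallyProper col = ∀ d → col (edge d) ≢ col (edge (φ d))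

  IncidentFace : Dart m → Fin m → Set
  IncidentFace d e = InOrbit φ d (e , false) ⊎ InOrbit φ d (e , true)

  incidentFace? : (d : Dart m) (e : Fin m) → Dec (IncidentFace d e)
  incidentFace? d e = any? (λ i → iter φ (toℕ i) d ≟D (e , false))
                 ⊎-dec any? (λ i → iter φ (toℕ i) d ≟D (e , true))

  countColor : (Fin m → ℕ) → Dart m → ℕ → ℕ
  countColor col d c =
    length (filter (λ e → incidentFace? d e ×-dec (col e ≟ℕ c)) (allFin m))

  ZeroOrOdd : ℕ → Set
  ZeroOrOdd n = n ≡ 0 ⊎ n % 2 ≡ 1

  FacialParity : (Fin m → ℕ) → Set
  FacialParity col = FaciallyProper col × (∀ d c → ZeroOrOdd (countColor col d c))

  numColors : (Fin m → ℕ) → ℕ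
  numColors col = length (deduplicate _≟ℕ_ (map col (allFin m)))

  χfp≡ : ℕ → Set
  χfp≡ k = (∃ λ col → FacialParity col × numColors col ≡ k)
         × (∀ col → FacialParity col → k ≤ numColors col)

-- The graph is the theta graph: three internally disjoint paths of lengths 4, 4 and 4k − 8
-- between two vertices, whose three faces are each bounded by two of the paths.  If a colour
-- occurs x, y and z times on the three paths, the faces see it x + y, y + z and z + x times;
-- these cannot all be zero or odd unless at most one of x, y, z is non-zero, since the three
-- sums add up to an even number.  So the paths use disjoint sets of colours, and on each path
-- every colour occurs zero or an odd number of times.  A properly coloured path whose length is
-- a positive multiple of 4 then needs four colours: with two colours it alternates, so each
-- occurs an even number of times, and three odd counts cannot add up to an even length.  This
-- gives at least 12 colours, and 12 suffice: colour the first twelve edges 0, …, 11 and let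
-- the rest of the long path alternate between 8 and 9.
module Submission where

open import Defs
open import Data.Nat using (ℕ; zero; suc; _+_; _*_; _∸_; _%_; _≤_; _<_; z≤n; s≤s; _≤?_; _<?_; parity)
open import Data.Nat.Properties
open import Data.Nat.DivMod using ([m+kn]%n≡m%n)
open import Data.Nat.Tactic.RingSolver using (solve-∀)
open import Data.Parity.Base as ℙ using (0ℙ; 1ℙ)
open import Data.Parity.Properties using (+-homo-+; *-homo-*)
open import Data.Bool using (Bool; true; false; not)
open import Data.Bool.Properties using (not-involutive) renaming (_≟_ to _≟B_)
open import Data.Fin as Fin using (Fin; toℕ; fromℕ<; _↑ʳ_)
open import Data.Fin.Properties using (toℕ<n; toℕ-fromℕ<; toℕ-injective; any?) renaming (_≟_ to _≟F_)
open import Data.List using (List; []; _∷_; _++_; length; filter; map; concatMap; take; drop; tabulate; allFin; deduplicate; upTo)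
open import Data.List.Properties
  using (length-++; length-map; length-tabulate; length-upTo; map-++; map-tabulate; ++-identityʳ;
         filter-++; filter-accept; filter-reject; filter-all; filter-none; filter-notAll; filter-≐)
open import Data.List.Membership.Propositional using (_∈_; _∉_; find)
open import Data.List.Membership.Propositional.Properties
  using (∈-++⁻; ∈-filter⁺; ∈-map⁻; ∈-deduplicate⁻; ∈-deduplicate⁺; ∈-upTo⁺; ∈-tabulate⁻)
open import Data.List.Membership.DecPropositional _≟_ using (_∈?_)
open import Data.List.Relation.Unary.All as All using (All; []; _∷_; all?)
open import Data.List.Relation.Unary.All.Properties using (¬All⇒Any¬)
import Data.List.Relation.Unary.All.Properties as AllP
open import Data.List.Relation.Unary.Any as Any using (here; there)
open import Data.List.Relation.Unary.Linked as Linked using (Linked; []; [-]; _∷_)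
open import Data.List.Relation.Unary.Unique.Propositional using (Unique; []; _∷_)
import Data.List.Relation.Unary.Unique.Propositional.Properties as Unique
open import Data.List.Relation.Unary.Unique.DecPropositional _≟_ using (unique?)
open import Data.List.Relation.Unary.Unique.DecPropositional.Properties _≟_ using (deduplicate-!)
open import Data.List.Relation.Binary.Disjoint.Propositional using (Disjoint)
open import Data.List.Relation.Binary.Subset.Propositional using (_⊆_)
import Data.List.Relation.Binary.Subset.Propositional.Properties as Subset
open import Data.Product using (Σ; _×_; _,_; proj₁; proj₂; ∃)
open import Data.Product.Properties using (≡-dec)
open import Data.Sum using (_⊎_; inj₁; inj₂; [_,_]′)
open import Data.Empty using (⊥; ⊥-elim)
open import Data.Unit using (tt)
open import Function using (_∘_; _∘′_)
open import Relation.Unary using (Decidable; _≐_)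
open import Relation.Nullary using (¬_; Dec; yes; no; ¬?)
open import Relation.Nullary.Decidable using (True; toWitness; _⊎-dec_; _×-dec_)
open import Relation.Binary.PropositionalEquality
open import Relation.Binary.Construct.Closure.ReflexiveTransitive using (Star; ε; _◅_; _◅◅_)
import Relation.Binary.Construct.Closure.ReflexiveTransitive as Star

count : ℕ → List ℕ → ℕ
count c [] = 0
count c (x ∷ xs) with x ≟ c
... | yes _ = suc (count c xs)
... | no  _ = count c xs

count-head : ∀ c xs → count c (c ∷ xs) ≡ suc (count c xs)
count-head c xs with c ≟ c
... | yes _  = refl
... | no c≢c = ⊥-elim (c≢c refl)

count-skip : ∀ {c x} xs → x ≢ c → count c (x ∷ xs) ≡ count c xs
count-skip {c} {x} xs x≢c with x ≟ c
... | yes x≡c = ⊥-elim (x≢c x≡c)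
... | no  _   = refl

count-++ : ∀ c xs ys → count c (xs ++ ys) ≡ count c xs + count c ys
count-++ c []       ys = refl
count-++ c (x ∷ xs) ys with x ≟ c
... | yes _ = cong suc (count-++ c xs ys)
... | no  _ = count-++ c xs ys

∈⇒count≢0 : ∀ {c xs} → c ∈ xs → count c xs ≢ 0
∈⇒count≢0 {c} {x ∷ xs} (here refl) rewrite count-head c xs = λ ()
∈⇒count≢0 {c} {x ∷ xs} (there c∈xs) with x ≟ c
... | yes _ = λ ()
... | no  _ = ∈⇒count≢0 c∈xs

∉∷⇒≢ : ∀ {y x} {xs : List ℕ} → y ∉ x ∷ xs → x ≢ y
∉∷⇒≢ y∉ x≡y = y∉ (here (sym x≡y))

∉⇒count≡0 : ∀ {c xs} → c ∉ xs → count c xs ≡ 0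
∉⇒count≡0 {c} {[]}     _    = refl
∉⇒count≡0 {c} {x ∷ xs} c∉xs with x ≟ c
... | yes refl = ⊥-elim (c∉xs (here refl))
... | no  _    = ∉⇒count≡0 (λ c∈xs → c∉xs (there c∈xs))

count-filter-map : ∀ {A : Set} {P : A → Set} (P? : Decidable P) (col : A → ℕ) c xs →
                   length (filter (λ x → P? x ×-dec (col x ≟ c)) xs) ≡ count c (map col (filter P? xs))
count-filter-map P? col c [] = refl
count-filter-map {P = P} P? col c (x ∷ xs) = step (P? x) (col x ≟ c)
  where
  open ≡-Reasoning
  Q? = λ y → P? y ×-dec (col y ≟ c)
  ih = count-filter-map P? col c xs
  step : Dec (P x) → Dec (col x ≡ c) →
         length (filter Q? (x ∷ xs)) ≡ count c (map col (filter P? (x ∷ xs)))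
  step (yes p) (yes refl) = begin
    length (filter Q? (x ∷ xs))                 ≡⟨ cong length (filter-accept Q? (p , refl)) ⟩
    suc (length (filter Q? xs))                 ≡⟨ cong suc ih ⟩
    suc (count (col x) (map col (filter P? xs))) ≡⟨ count-head (col x) _ ⟨
    count (col x) (map col (x ∷ filter P? xs))  ≡⟨ cong (count (col x) ∘ map col) (filter-accept P? p) ⟨
    count (col x) (map col (filter P? (x ∷ xs))) ∎
  step (yes p) (no col-x≢c) = begin
    length (filter Q? (x ∷ xs))                 ≡⟨ cong length (filter-reject Q? (col-x≢c ∘ proj₂)) ⟩
    length (filter Q? xs)                       ≡⟨ ih ⟩
    count c (map col (filter P? xs))            ≡⟨ count-skip _ col-x≢c ⟨
    count c (map col (x ∷ filter P? xs))        ≡⟨ cong (count c ∘ map col) (filter-accept P? p) ⟨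
    count c (map col (filter P? (x ∷ xs)))      ∎
  step (no ¬p) _ = begin
    length (filter Q? (x ∷ xs))                 ≡⟨ cong length (filter-reject Q? (¬p ∘ proj₁)) ⟩
    length (filter Q? xs)                       ≡⟨ ih ⟩
    count c (map col (filter P? xs))            ≡⟨ cong (count c ∘ map col) (filter-reject P? ¬p) ⟨
    count c (map col (filter P? (x ∷ xs)))      ∎

ZeroOrOdd : ℕ → Set
ZeroOrOdd n = n ≡ 0 ⊎ n % 2 ≡ 1

%2≡1⇒parity≡1ℙ : ∀ n → n % 2 ≡ 1 → parity n ≡ 1ℙ
%2≡1⇒parity≡1ℙ 1             _ = refl
%2≡1⇒parity≡1ℙ (suc (suc n)) p = %2≡1⇒parity≡1ℙ n p

zeroOrOdd⇒parity≡1ℙ : ∀ {n} → ZeroOrOdd n → n ≢ 0 → parity n ≡ 1ℙ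
zeroOrOdd⇒parity≡1ℙ (inj₁ n≡0) n≢0 = ⊥-elim (n≢0 n≡0)
zeroOrOdd⇒parity≡1ℙ {n} (inj₂ odd) _ = %2≡1⇒parity≡1ℙ n odd

0ℙ≢1ℙ : 0ℙ ≢ 1ℙ
0ℙ≢1ℙ ()

parity-double : ∀ n → parity (2 * n) ≡ 0ℙ
parity-double n = *-homo-* 2 n

zeroOrOdd-sums⇒≡0 : ∀ x y z → ZeroOrOdd (x + y) → ZeroOrOdd (y + z) → ZeroOrOdd (z + x) →
                    x ≡ 0 ⊎ y ≡ 0
zeroOrOdd-sums⇒≡0 x y z (inj₁ x+y≡0) _ _ = inj₁ (m+n≡0⇒m≡0 x x+y≡0)
zeroOrOdd-sums⇒≡0 x y z _ (inj₁ y+z≡0) _ = inj₂ (m+n≡0⇒m≡0 y y+z≡0)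
zeroOrOdd-sums⇒≡0 x y z _ _ (inj₁ z+x≡0) = inj₁ (m+n≡0⇒n≡0 z z+x≡0)
zeroOrOdd-sums⇒≡0 x y z (inj₂ p) (inj₂ q) (inj₂ r) = ⊥-elim (0ℙ≢1ℙ (sym (begin
  1ℙ                                               ≡⟨⟩
  1ℙ ℙ.+ 1ℙ ℙ.+ 1ℙ
    ≡⟨ cong₂ ℙ._+_ (cong₂ ℙ._+_ (odd (x + y) p) (odd (y + z) q)) (odd (z + x) r) ⟨
  parity (x + y) ℙ.+ parity (y + z) ℙ.+ parity (z + x) ≡⟨ cong (ℙ._+ parity (z + x)) (+-homo-+ (x + y) (y + z)) ⟨
  parity (x + y + (y + z)) ℙ.+ parity (z + x)      ≡⟨ +-homo-+ (x + y + (y + z)) (z + x) ⟨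
  parity (x + y + (y + z) + (z + x))               ≡⟨ cong parity (double-sum x y z) ⟩
  parity (2 * (x + y + z))                         ≡⟨ parity-double (x + y + z) ⟩
  0ℙ                                               ∎)))
  where
  open ≡-Reasoning
  odd = %2≡1⇒parity≡1ℙ
  double-sum : ∀ x y z → x + y + (y + z) + (z + x) ≡ 2 * (x + y + z)
  double-sum = solve-∀

ParityList : List ℕ → Set
ParityList xs = ∀ c → ZeroOrOdd (count c xs)

unique⇒parityList : ∀ {xs} → Unique xs → ParityList xs
unique⇒parityList {[]}     _              c = inj₁ refl
unique⇒parityList {x ∷ xs} (x∉xs ∷ uniq) c with x ≟ c
... | yes refl = inj₂ (cong (λ n → suc n % 2) (∉⇒count≡0 λ x∈xs → All.lookup x∉xs x∈xs refl))
... | no  _    = unique⇒parityList uniq c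

parityList-++-comm : ∀ xs ys → ParityList (xs ++ ys) → ParityList (ys ++ xs)
parityList-++-comm xs ys p c = subst ZeroOrOdd
  (trans (count-++ c xs ys) (trans (+-comm (count c xs) (count c ys)) (sym (count-++ c ys xs)))) (p c)

module ThreePaths (u v w : List ℕ)
  (uv : ParityList (u ++ v)) (vw : ParityList (v ++ w)) (wu : ParityList (w ++ u)) where

  private
    split : ∀ c xs ys → ParityList (xs ++ ys) → ZeroOrOdd (count c xs + count c ys)
    split c xs ys p = subst ZeroOrOdd (count-++ c xs ys) (p c)

  count≡0 : ∀ c → count c u ≡ 0 ⊎ count c v ≡ 0
  count≡0 c = zeroOrOdd-sums⇒≡0 (count c u) (count c v) (count c w)
                (split c u v uv) (split c v w vw) (split c w u wu)

  disjoint : Disjoint u v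
  disjoint {c} (c∈u , c∈v) with count≡0 c
  ... | inj₁ e = ∈⇒count≢0 c∈u e
  ... | inj₂ e = ∈⇒count≢0 c∈v e

  parityList : ParityList u
  parityList c with count≡0 c
  ... | inj₁ e = inj₁ e
  ... | inj₂ e = subst ZeroOrOdd (trans (cong (count c u +_) e) (+-identityʳ _)) (split c u v uv)

count-alternating : ∀ {a b} → a ≢ b → ∀ n xs → length xs ≡ n + n →
                    All (_∈ a ∷ b ∷ []) xs → Linked _≢_ xs → count a xs ≡ n
count-alternating a≢b zero    []  _ _ _ = refl
count-alternating a≢b (suc n) (x ∷ []) len _ _ = ⊥-elim (0≢1+n (trans (suc-injective len) (+-suc n n)))
count-alternating {a} {b} a≢b (suc n) (x ∷ y ∷ zs) len (x∈ ∷ y∈ ∷ zs∈) (x≢y ∷ linked) =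
  trans (count-pair x∈ y∈ x≢y)
        (cong suc (count-alternating a≢b n zs (suc-injective (trans (suc-injective len) (+-suc n n)))
                     zs∈ (Linked.tail linked)))
  where
  count-pair : ∀ {x y} → x ∈ a ∷ b ∷ [] → y ∈ a ∷ b ∷ [] → x ≢ y → count a (x ∷ y ∷ zs) ≡ suc (count a zs)
  count-pair (here refl) (here refl) x≢y = ⊥-elim (x≢y refl)
  count-pair (here refl) (there (here refl)) _ =
    trans (count-head a (b ∷ zs)) (cong suc (count-skip zs (≢-sym a≢b)))
  count-pair (there (here refl)) (here refl) _ =
    trans (count-skip (a ∷ zs) (≢-sym a≢b)) (count-head a zs)
  count-pair (there (here refl)) (there (here refl)) x≢y = ⊥-elim (x≢y refl)

length≡count+count+count : ∀ {a b c} → a ≢ b → b ≢ c → a ≢ c → ∀ xs → All (_∈ a ∷ b ∷ c ∷ []) xs →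
                           length xs ≡ count a xs + count b xs + count c xs
length≡count+count+count a≢b b≢c a≢c [] [] = refl
length≡count+count+count {a} {b} {c} a≢b b≢c a≢c (x ∷ xs) (x∈ ∷ xs∈) with x∈
... | here refl
  rewrite count-head a xs | count-skip {b} xs a≢b | count-skip {c} xs a≢c = cong suc ih
  where ih = length≡count+count+count a≢b b≢c a≢c xs xs∈
... | there (here refl)
  rewrite count-skip {a} xs (≢-sym a≢b) | count-head b xs | count-skip {c} xs b≢c
        | +-suc (count a xs) (count b xs) = cong suc ih
  where ih = length≡count+count+count a≢b b≢c a≢c xs xs∈
... | there (there (here refl))
  rewrite count-skip {a} xs (≢-sym a≢c) | count-skip {b} xs (≢-sym b≢c) | count-head c xs
        | +-suc (count a xs + count b xs) (count c xs) = cong suc ih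
  where ih = length≡count+count+count a≢b b≢c a≢c xs xs∈

quadruple≡double+double : ∀ j → suc j * 4 ≡ 2 * suc j + 2 * suc j
quadruple≡double+double = solve-∀

quadruple≡double-double : ∀ j → suc j * 4 ≡ 2 * (2 * suc j)
quadruple≡double-double = solve-∀

four-colours : ∀ j xs → length xs ≡ suc j * 4 → Linked _≢_ xs → ParityList xs →
               Σ (List ℕ) λ L → length L ≡ 4 × Unique L × L ⊆ xs
four-colours j (a ∷ b ∷ zs) len linked@(a≢b ∷ _) par
  with all? (_∈? a ∷ b ∷ []) (a ∷ b ∷ zs)
... | yes two = ⊥-elim (0ℙ≢1ℙ (begin
  0ℙ                              ≡⟨ parity-double (suc j) ⟨
  parity (2 * suc j)              ≡⟨ cong parity (count-alternating a≢b (2 * suc j) _ halves two linked) ⟨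
  parity (count a (a ∷ b ∷ zs))   ≡⟨ zeroOrOdd⇒parity≡1ℙ (par a) (∈⇒count≢0 {xs = a ∷ b ∷ zs} (here refl)) ⟩
  1ℙ                              ∎))
  where
  open ≡-Reasoning
  halves : length (a ∷ b ∷ zs) ≡ 2 * suc j + 2 * suc j
  halves = trans len (quadruple≡double+double j)
... | no ¬two with find (¬All⇒Any¬ (_∈? a ∷ b ∷ []) _ ¬two)
... | c , c∈ , c∉ with all? (_∈? a ∷ b ∷ c ∷ []) (a ∷ b ∷ zs)
... | yes three = ⊥-elim (0ℙ≢1ℙ (begin
  0ℙ                              ≡⟨ parity-double (2 * suc j) ⟨
  parity (2 * (2 * suc j))        ≡⟨ cong parity (trans len (quadruple≡double-double j)) ⟨
  parity (length xs)              ≡⟨ cong parity (length≡count+count+count a≢b b≢c a≢c xs three) ⟩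
  parity (count a xs + count b xs + count c xs)
    ≡⟨ trans (+-homo-+ (count a xs + count b xs) (count c xs))
             (cong (ℙ._+ parity (count c xs)) (+-homo-+ (count a xs) (count b xs))) ⟩
  parity (count a xs) ℙ.+ parity (count b xs) ℙ.+ parity (count c xs)
    ≡⟨ cong₂ ℙ._+_ (cong₂ ℙ._+_ (odd a (here refl)) (odd b (there (here refl)))) (odd c c∈) ⟩
  1ℙ                              ∎))
  where
  open ≡-Reasoning
  xs = a ∷ b ∷ zs
  a≢c = ∉∷⇒≢ c∉
  b≢c = ∉∷⇒≢ (c∉ ∘ there)
  odd : ∀ x → x ∈ xs → parity (count x xs) ≡ 1ℙ
  odd x x∈ = zeroOrOdd⇒parity≡1ℙ (par x) (∈⇒count≢0 x∈)
... | no ¬three with find (¬All⇒Any¬ (_∈? a ∷ b ∷ c ∷ []) _ ¬three)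
... | d , d∈ , d∉ =
  a ∷ b ∷ c ∷ d ∷ [] , refl ,
  ((a≢b ∷ a≢c ∷ a≢d ∷ []) ∷ (b≢c ∷ b≢d ∷ []) ∷ (c≢d ∷ []) ∷ [] ∷ []) ,
  λ { (here refl) → here refl
    ; (there (here refl)) → there (here refl)
    ; (there (there (here refl))) → c∈
    ; (there (there (there (here refl)))) → d∈ }
  where
  a≢c = ∉∷⇒≢ c∉
  b≢c = ∉∷⇒≢ (c∉ ∘ there)
  a≢d = ∉∷⇒≢ d∉
  b≢d = ∉∷⇒≢ (d∉ ∘ there)
  c≢d = ∉∷⇒≢ (d∉ ∘ there ∘ there)

twelve-colours : ∀ {u v w} i j k → length u ≡ suc i * 4 → length v ≡ suc j * 4 → length w ≡ suc k * 4 →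
                 Linked _≢_ u → Linked _≢_ v → Linked _≢_ w →
                 ParityList (u ++ v) → ParityList (v ++ w) → ParityList (w ++ u) →
                 Σ (List ℕ) λ L → length L ≡ 12 × Unique L × L ⊆ u ++ v ++ w
twelve-colours {u} {v} {w} i j k |u| |v| |w| lu lv lw uv vw wu
  with four-colours i u |u| lu (ThreePaths.parityList u v w uv vw wu)
     | four-colours j v |v| lv (ThreePaths.parityList v w u vw wu uv)
     | four-colours k w |w| lw (ThreePaths.parityList w u v wu uv vw)
... | U , |U| , uniqueU , U⊆u | V , |V| , uniqueV , V⊆v | W , |W| , uniqueW , W⊆w =
  U ++ V ++ W ,
  trans (length-++ U) (cong₂ _+_ |U| (trans (length-++ V) (cong₂ _+_ |V| |W|))) ,
  Unique.++⁺ uniqueU (Unique.++⁺ uniqueV uniqueW V#W) U#VW ,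
  Subset.++⁺ U⊆u (Subset.++⁺ V⊆v W⊆w)
  where
  V#W : Disjoint V W
  V#W (x∈V , x∈W) = ThreePaths.disjoint v w u vw wu uv (V⊆v x∈V , W⊆w x∈W)
  U#VW : Disjoint U (V ++ W)
  U#VW (x∈U , x∈VW) with ∈-++⁻ V x∈VW
  ... | inj₁ x∈V = ThreePaths.disjoint u v w uv vw wu (U⊆u x∈U , V⊆v x∈V)
  ... | inj₂ x∈W = ThreePaths.disjoint w u v wu uv vw (W⊆w x∈W , U⊆u x∈U)

unique-⊆⇒length≤ : ∀ {xs ys : List ℕ} → Unique xs → xs ⊆ ys → length xs ≤ length ys
unique-⊆⇒length≤ {[]}     _              _     = z≤n
unique-⊆⇒length≤ {x ∷ xs} {ys} (x∉xs ∷ uniq) xs⊆ys =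
  ≤-trans (s≤s (unique-⊆⇒length≤ uniq xs⊆ys-x)) (filter-notAll ≢x? ys x∈ys)
  where
  x∈ys = Any.map (λ { refl x≢x → x≢x refl }) (xs⊆ys (here refl))
  ≢x? : ∀ y → Dec (y ≢ x)
  ≢x? y = ¬? (y ≟ x)
  xs⊆ys-x : xs ⊆ filter ≢x? ys
  xs⊆ys-x z∈xs = ∈-filter⁺ ≢x? (xs⊆ys (there z∈xs)) (λ z≡x → All.lookup x∉xs z∈xs (sym z≡x))

iter-shift : ∀ {A : Set} (f : A → A) n x → iter f n (f x) ≡ iter f (suc n) x
iter-shift f zero    x = refl
iter-shift f (suc n) x = cong f (iter-shift f n x)

iter-+ : ∀ {A : Set} (f : A → A) a b x → iter f (a + b) x ≡ iter f a (iter f b x)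
iter-+ f zero    b x = refl
iter-+ f (suc a) b x = cong f (iter-+ f a b x)

module Periodic {A : Set} (f : A → A) (x : A) (L : ℕ) (period : iter f (suc L) x ≡ x) where

  orbit : ∀ k → ∃ λ r → r ≤ L × iter f k x ≡ iter f r x
  orbit zero = 0 , z≤n , refl
  orbit (suc k) with orbit k
  ... | r , r≤L , eq with r <? L
  ...   | yes r<L = suc r , r<L , cong f eq
  ...   | no  r≮L = 0 , z≤n , trans (cong f eq) (trans (cong (λ n → iter f (suc n) x) (≤∧≮⇒≡ r≤L r≮L)) period)

  orbit-from : ∀ k s → ∃ λ r → r ≤ L × iter f k (iter f s x) ≡ iter f r x
  orbit-from k s with orbit (k + s)
  ... | r , r≤L , eq = r , r≤L , trans (sym (iter-+ f k s x)) eq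

  reach : ∀ {s r} → s ≤ L → r ≤ L → ∃ λ k → k ≤ L × iter f k (iter f s x) ≡ iter f r x
  reach {s} {r} s≤L r≤L with s ≤? r
  ... | yes s≤r = r ∸ s , ≤-trans (m∸n≤m r s) r≤L ,
                  trans (sym (iter-+ f (r ∸ s) s x)) (cong (λ n → iter f n x) (m∸n+n≡m s≤r))
  ... | no  s≰r = r + (suc L ∸ s) , ≤-pred bound , (begin
    iter f (r + (suc L ∸ s)) (iter f s x) ≡⟨ iter-+ f (r + (suc L ∸ s)) s x ⟨
    iter f (r + (suc L ∸ s) + s) x        ≡⟨ cong (λ n → iter f n x) (trans (+-assoc r _ s) (cong (r +_) wrap)) ⟩
    iter f (r + suc L) x                  ≡⟨ iter-+ f r (suc L) x ⟩
    iter f r (iter f (suc L) x)           ≡⟨ cong (iter f r) period ⟩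
    iter f r x                            ∎)
    where
    open ≡-Reasoning
    wrap : suc L ∸ s + s ≡ suc L
    wrap = m∸n+n≡m (m≤n⇒m≤1+n s≤L)
    bound : suc (r + (suc L ∸ s)) ≤ suc L
    bound = ≤-trans (+-monoˡ-< (suc L ∸ s) (≰⇒> s≰r)) (≤-reflexive (m+[n∸m]≡n (m≤n⇒m≤1+n s≤L)))

module _ {m : ℕ} (G : Map m) where
  open Map G hiding (ZeroOrOdd)

  isRep-of-closed : ∀ (π : Dart m → Dart m) (S : Dart m → Set) {d} → S d → (∀ {y} → S y → S (π y)) →
                    (∀ {y} → S y → idx d ≤ idx y) → IsRep π d
  isRep-of-closed π S {d} d∈S closed minimal i = minimal (orbit⊆S (toℕ i))
    where
    orbit⊆S : ∀ n → S (iter π n d)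
    orbit⊆S zero    = d∈S
    orbit⊆S (suc n) = closed (orbit⊆S n)

  ¬isRep-of-smaller : ∀ (π : Dart m → Dart m) {d} k → k < m + m → idx (iter π k d) < idx d → ¬ IsRep π d
  ¬isRep-of-smaller π {d} k k<2m smaller rep =
    <⇒≱ smaller (subst (λ n → idx d ≤ idx (iter π n d)) (toℕ-fromℕ< k<2m) (rep (fromℕ< k<2m)))

  -- Stated for numVertices and numFaces themselves, so that using them on a concrete map
  -- never asks Agda to unfold the orbit count, which would evaluate IsRep on every dart.
  numVertices-≐ : ∀ {Q : Dart m → Set} (Q? : Decidable Q) → IsRep σ ≐ Q →
                  numVertices ≡ length (filter Q? (darts m))
  numVertices-≐ Q? rep≐Q = cong length (filter-≐ (isRep? σ) Q? rep≐Q (darts m))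

  numFaces-≐ : ∀ {Q : Dart m → Set} (Q? : Decidable Q) → IsRep φ ≐ Q →
               numFaces ≡ length (filter Q? (darts m))
  numFaces-≐ Q? rep≐Q = cong length (filter-≐ (isRep? φ) Q? rep≐Q (darts m))

  countColor-≐ : ∀ col d c {P : Fin m → Set} (P? : Decidable P) → IncidentFace d ≐ P →
                 countColor col d c ≡ length (filter (λ e → P? e ×-dec (col e ≟ c)) (allFin m))
  countColor-≐ col d c P? (inc⇒P , P⇒inc) = cong length
    (filter-≐ (λ e → incidentFace? d e ×-dec (col e ≟ c)) (λ e → P? e ×-dec (col e ≟ c))
              ((λ (inc , col≡c) → inc⇒P inc , col≡c) , (λ (p , col≡c) → P⇒inc p , col≡c)) (allFin m))

  -- All arguments are explicit: inferring them would make Agda unfold countColor.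
  zeroOrOdd-countColor : ∀ col d c {n} → countColor col d c ≡ n → ZeroOrOdd n → Map.ZeroOrOdd G (countColor col d c)
  zeroOrOdd-countColor col d c eq = subst ZeroOrOdd (sym eq)

  facialParity⇒zeroOrOdd : ∀ col d c {n} → FacialParity col → countColor col d c ≡ n → ZeroOrOdd n
  facialParity⇒zeroOrOdd col d c (_ , parity) eq = subst ZeroOrOdd eq (parity d c)

  numColors≤ : ∀ col {n} → (∀ e → col e < n) → numColors col ≤ n
  numColors≤ col {n} col<n = subst (numColors col ≤_) (length-upTo n)
    (unique-⊆⇒length≤ (deduplicate-! (map col (allFin m))) colours<n)
    where
    colours<n : deduplicate _≟_ (map col (allFin m)) ⊆ upTo n
    colours<n c∈ with ∈-map⁻ col (∈-deduplicate⁻ _≟_ (map col (allFin m)) c∈)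
    ... | e , _ , refl = ∈-upTo⁺ (col<n e)

  numColors≥ : ∀ col {L} → Unique L → L ⊆ map col (allFin m) → length L ≤ numColors col
  numColors≥ col unique L⊆ = unique-⊆⇒length≤ unique (∈-deduplicate⁺ _≟_ ∘ L⊆)

  incident-at : ∀ {d e} b (k : Fin (m + m)) → iter φ (toℕ k) d ≡ (e , b) → IncidentFace d e
  incident-at false k eq = inj₁ (k , eq)
  incident-at true  k eq = inj₂ (k , eq)

  Walk : (Fin m → Set) → Dart m → Dart m → Set
  Walk P = Star (Step P)

  walk-around : ∀ {P} n d → Walk P d (iter σ n d)
  walk-around zero    d = ε
  walk-around (suc n) d = walk-around n d ◅◅ around (iter σ n d) ◅ ε

  walk-face : ∀ {P} d → P (edge d) → Walk P d (φ d)
  walk-face d p = along d p ◅ around (α d) ◅ ε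

  walk-weaken : ∀ {P Q : Fin m → Set} → (∀ {e} → P e → Q e) → ∀ {x y} → Walk P x y → Walk Q x y
  walk-weaken P⊆Q = Star.map λ { (around d) → around d ; (along d p) → along d (P⊆Q p) }

  module Reversible (n : ℕ) (σ-order : ∀ d → iter σ (suc n) d ≡ d) where

    step-back : ∀ {P x y} → Step P x y → Walk P y x
    step-back {P} (around d)        = subst (Walk P (σ d)) (trans (iter-shift σ n d) (σ-order d)) (walk-around n (σ d))
    step-back {P} (along (e , b) p) = subst (Walk P (e , not b)) (cong (e ,_) (not-involutive b)) (along (e , not b) p ◅ ε)

    walk-reverse : ∀ {P x y} → Walk P x y → Walk P y x
    walk-reverse ε       = ε
    walk-reverse (s ◅ w) = walk-reverse w ◅◅ step-back s

    -- A face whose boundary walk passes each edge at most once: deleting an edge e cuts the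
    -- boundary cycle open in one place, so every dart can still reach the start, going backwards
    -- if e comes before it and forwards round the cycle otherwise.
    module FaceCycle (d₀ : Dart m) (L : ℕ) (closed : iter φ (suc L) d₀ ≡ d₀)
                     (edge-injective : ∀ {k k'} → k ≤ L → k' ≤ L →
                                       edge (iter φ k d₀) ≡ edge (iter φ k' d₀) → k ≡ k') where

      walk-along : ∀ {e} a b → a ≤ b → (∀ k → a ≤ k → k < b → edge (iter φ k d₀) ≢ e) →
                   Walk (_≢ e) (iter φ a d₀) (iter φ b d₀)
      walk-along a zero z≤n _ = ε
      walk-along a (suc b) a≤1+b avoid with a ≟ suc b
      ... | yes refl = ε
      ... | no  a≢1+b = walk-along a b a≤b (λ k a≤k k<b → avoid k a≤k (m<n⇒m<1+n k<b))
                        ◅◅ walk-face (iter φ b d₀) (avoid b a≤b ≤-refl)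
        where a≤b = ≤-pred (≤∧≢⇒< a≤1+b a≢1+b)

      walk-to-start : ∀ e s → s ≤ L → Walk (_≢ e) (iter φ s d₀) d₀
      walk-to-start e s s≤L with any? {n = s} (λ i → edge (iter φ (toℕ i) d₀) ≟F e)
      ... | no  e∉prefix = walk-reverse (walk-along 0 s z≤n avoid)
        where
        avoid : ∀ k → 0 ≤ k → k < s → edge (iter φ k d₀) ≢ e
        avoid k _ k<s eq = e∉prefix (fromℕ< k<s , subst (λ j → edge (iter φ j d₀) ≡ e) (sym (toℕ-fromℕ< k<s)) eq)
      ... | yes (i , eq) = subst (Walk (_≢ e) (iter φ s d₀)) closed (walk-along s (suc L) (m≤n⇒m≤1+n s≤L) avoid)
        where
        avoid : ∀ k → s ≤ k → k < suc L → edge (iter φ k d₀) ≢ e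
        avoid k s≤k k<1+L eq′ = <⇒≢ (<-≤-trans (toℕ<n i) s≤k)
          (edge-injective (≤-trans (<⇒≤ (toℕ<n i)) s≤L) (≤-pred k<1+L) (trans eq (sym eq′)))

-- Edges 0–3, 4–7 and 8–M form three paths between two poles; the dart (i , false) is the end
-- of edge i towards the first pole and (i , true) the end towards the second.  The rotation
-- cycles (0,f) ↦ (8,f) ↦ (4,f) at the first pole, (3,t) ↦ (7,t) ↦ (M,t) at the second, and
-- swaps (i,t) and (i+1,f) at every inner vertex.
module Theta (N : ℕ) where

  m M : ℕ
  m = 12 + N
  M = 11 + N

  Code : Set
  Code = ℕ × Bool

  rot-back rot-front : ℕ → Code
  rot-back 0 = 8 , false
  rot-back 4 = 0 , false
  rot-back 8 = 4 , false
  rot-back (suc i) = i , true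
  rot-front 3 = 7 , true
  rot-front 7 = M , true
  rot-front i with i ≟ M
  ... | yes _ = 3 , true
  ... | no  _ = suc i , false

  σᶜ φᶜ : Code → Code
  σᶜ (i , false) = rot-back i
  σᶜ (i , true)  = rot-front i
  φᶜ (i , b)     = σᶜ (i , not b)

  rot-front-M : rot-front M ≡ (3 , true)
  rot-front-M with M ≟ M
  ... | yes _   = refl
  ... | no  M≢M = ⊥-elim (M≢M refl)

  rot-front-inner : ∀ i → i ≢ 3 → i ≢ 7 → i ≢ M → rot-front i ≡ (suc i , false)
  rot-front-inner 0 _ _ _ = refl
  rot-front-inner 1 _ _ _ = refl
  rot-front-inner 2 _ _ _ = refl
  rot-front-inner 3 i≢3 _ _ = ⊥-elim (i≢3 refl)
  rot-front-inner 4 _ _ _ = refl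
  rot-front-inner 5 _ _ _ = refl
  rot-front-inner 6 _ _ _ = refl
  rot-front-inner 7 _ i≢7 _ = ⊥-elim (i≢7 refl)
  rot-front-inner i@(suc (suc (suc (suc (suc (suc (suc (suc _)))))))) _ _ i≢M with i ≟ M
  ... | yes i≡M = ⊥-elim (i≢M i≡M)
  ... | no  _   = refl

  rot-back-inner : ∀ i → suc i ≢ 4 → suc i ≢ 8 → rot-back (suc i) ≡ (i , true)
  rot-back-inner 0 _ _ = refl
  rot-back-inner 1 _ _ = refl
  rot-back-inner 2 _ _ = refl
  rot-back-inner 3 i≢4 _ = ⊥-elim (i≢4 refl)
  rot-back-inner 4 _ _ = refl
  rot-back-inner 5 _ _ = refl
  rot-back-inner 6 _ _ = refl
  rot-back-inner 7 _ i≢8 = ⊥-elim (i≢8 refl)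
  rot-back-inner (suc (suc (suc (suc (suc (suc (suc (suc _)))))))) _ _ = refl

  ≤-lit : ∀ {a b} {a≤b : True (a ≤? b)} → a ≤ b
  ≤-lit {a≤b = a≤b} = toWitness a≤b

  <m : ∀ k → {True (k <? 12)} → k < m
  <m k {k<12} = ≤-trans (toWitness k<12) (m≤m+n 12 N)

  pred⁸ : ∀ {i n} → 8 + i ≤ 8 + n → i ≤ n
  pred⁸ (s≤s (s≤s (s≤s (s≤s (s≤s (s≤s (s≤s (s≤s i≤n)))))))) = i≤n

  rot-back-bound : ∀ i → i < m → proj₁ (rot-back i) < m
  rot-back-bound 0 _ = <m 8
  rot-back-bound (suc i) i<m with suc i ≟ 4 | suc i ≟ 8
  ... | yes refl | _        = <m 0
  ... | no _     | yes refl = <m 4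
  ... | no i≢4   | no i≢8   rewrite rot-back-inner i i≢4 i≢8 = <-trans (n<1+n i) i<m

  rot-front-bound : ∀ i → i < m → proj₁ (rot-front i) < m
  rot-front-bound i i<m with i ≟ 3 | i ≟ 7 | i ≟ M
  ... | yes refl | _        | _        = <m 7
  ... | no _     | yes refl | _        = ≤-refl
  ... | no _     | no _     | yes refl rewrite rot-front-M = <m 3
  ... | no i≢3   | no i≢7   | no i≢M   rewrite rot-front-inner i i≢3 i≢7 i≢M = s≤s (≤∧≢⇒< (≤-pred i<m) i≢M)

  Valid : Code → Set
  Valid (i , _) = i < m

  σᶜ-valid : ∀ x → Valid x → Valid (σᶜ x)
  σᶜ-valid (i , false) = rot-back-bound i
  σᶜ-valid (i , true)  = rot-front-bound i

  -- Every vertex has degree 2 or 3, so σ⁶ is the identity and σ⁵ inverts σ.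
  σᶜ-order : ∀ x → Valid x → σᶜ (σᶜ x) ≡ x ⊎ σᶜ (σᶜ (σᶜ x)) ≡ x
  σᶜ-order (zero , false) _ = inj₂ refl
  σᶜ-order (suc i , false) i<m with suc i ≟ 4 | suc i ≟ 8
  ... | yes refl | _        = inj₂ refl
  ... | no _     | yes refl = inj₂ refl
  ... | no i≢4   | no i≢8
    rewrite rot-back-inner i i≢4 i≢8
          | rot-front-inner i (i≢4 ∘′ cong suc) (i≢8 ∘′ cong suc) (<⇒≢ (≤-pred i<m)) = inj₁ refl
  σᶜ-order (i , true) i<m with i ≟ 3 | i ≟ 7 | i ≟ M
  ... | yes refl | _        | _        = inj₂ rot-front-M
  ... | no _     | yes refl | _        rewrite rot-front-M = inj₂ refl
  ... | no _     | no _     | yes refl rewrite rot-front-M = inj₂ refl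
  ... | no i≢3   | no i≢7   | no i≢M
    rewrite rot-front-inner i i≢3 i≢7 i≢M
          | rot-back-inner i (i≢3 ∘′ suc-injective) (i≢7 ∘′ suc-injective) = inj₁ refl

  σᶜ⁶ : ∀ x → Valid x → iter σᶜ 6 x ≡ x
  σᶜ⁶ x valid with σᶜ-order x valid
  ... | inj₁ σ²≡id = trans (cong (λ y → σᶜ (σᶜ (σᶜ (σᶜ y)))) σ²≡id) (trans (cong (λ y → σᶜ (σᶜ y)) σ²≡id) σ²≡id)
  ... | inj₂ σ³≡id = trans (cong (λ y → σᶜ (σᶜ (σᶜ y))) σ³≡id) σ³≡id

  enc : Dart m → Code
  enc (e , b) = toℕ e , b

  enc-injective : ∀ {d d′} → enc d ≡ enc d′ → d ≡ d′
  enc-injective {e , b} {e′ , b′} eq = cong₂ _,_ (toℕ-injective (cong proj₁ eq)) (cong proj₂ eq)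

  enc-valid : ∀ d → Valid (enc d)
  enc-valid (e , _) = toℕ<n e

  decode : ∀ x → Valid x → Dart m
  decode (i , b) i<m = fromℕ< i<m , b

  enc-decode : ∀ x (valid : Valid x) → enc (decode x valid) ≡ x
  enc-decode (i , b) i<m = cong (_, b) (toℕ-fromℕ< i<m)

  σ : Dart m → Dart m
  σ d = decode (σᶜ (enc d)) (σᶜ-valid (enc d) (enc-valid d))

  enc-σ : ∀ d → enc (σ d) ≡ σᶜ (enc d)
  enc-σ d = enc-decode (σᶜ (enc d)) (σᶜ-valid (enc d) (enc-valid d))

  enc-iter-σ : ∀ n d → enc (iter σ n d) ≡ iter σᶜ n (enc d)
  enc-iter-σ zero    d = refl
  enc-iter-σ (suc n) d = trans (enc-σ (iter σ n d)) (cong σᶜ (enc-iter-σ n d))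

  σ-order : ∀ d → iter σ 6 d ≡ d
  σ-order d = enc-injective (trans (enc-iter-σ 6 d) (σᶜ⁶ (enc d) (enc-valid d)))

  Θ : Map m
  Θ = record
    { σ   = σ
    ; σ⁻  = iter σ 5
    ; σσ⁻ = σ-order
    ; σ⁻σ = λ d → trans (iter-shift σ 5 d) (σ-order d)
    }

  open Map Θ using (φ; IsRep; IncidentFace; around; along)

  enc-φ : ∀ d → enc (φ d) ≡ φᶜ (enc d)
  enc-φ (e , b) = enc-σ (e , not b)

  data Face : Set where
    A B C : Face

  -- The boundary walk of each face from its start dart: A runs along paths 1 and 2, B along
  -- paths 2 and 3, C along paths 3 and 1; `last F` is the position of its final dart.
  boundary : Face → ℕ → Code
  boundary A 0 = 0 , false
  boundary A 1 = 1 , false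
  boundary A 2 = 2 , false
  boundary A 3 = 3 , false
  boundary A (suc (suc (suc (suc t)))) = 7 ∸ t , true
  boundary B 0 = 4 , false
  boundary B 1 = 5 , false
  boundary B 2 = 6 , false
  boundary B 3 = 7 , false
  boundary B (suc (suc (suc (suc t)))) = 8 + (3 + N ∸ t) , true
  boundary C 0 = 3 , true
  boundary C 1 = 2 , true
  boundary C 2 = 1 , true
  boundary C 3 = 0 , true
  boundary C (suc (suc (suc (suc t)))) = 8 + t , false

  last : Face → ℕ
  last A = 7
  last B = 7 + N
  last C = 7 + N

  boundary-step : ∀ F s → s < last F → φᶜ (boundary F s) ≡ boundary F (suc s)
  boundary-step A 0 _ = refl
  boundary-step A 1 _ = refl
  boundary-step A 2 _ = refl
  boundary-step A 3 _ = refl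
  boundary-step A 4 _ = refl
  boundary-step A 5 _ = refl
  boundary-step A 6 _ = refl
  boundary-step A (suc (suc (suc (suc (suc (suc (suc _))))))) (s≤s (s≤s (s≤s (s≤s (s≤s (s≤s (s≤s ())))))))
  boundary-step B 0 _ = refl
  boundary-step B 1 _ = refl
  boundary-step B 2 _ = refl
  boundary-step B 3 _ = refl
  boundary-step B (suc (suc (suc (suc t)))) (s≤s (s≤s (s≤s (s≤s t<3+N))))
    rewrite +-∸-assoc 1 (≤-pred t<3+N) = refl
  boundary-step C 0 _ = refl
  boundary-step C 1 _ = refl
  boundary-step C 2 _ = refl
  boundary-step C 3 _ = refl
  boundary-step C (suc (suc (suc (suc t)))) (s≤s (s≤s (s≤s (s≤s t<3+N)))) =
    rot-front-inner (8 + t) (λ ()) (λ ()) (<⇒≢ (+-monoʳ-< 8 t<3+N))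

  boundary-wrap : ∀ F → φᶜ (boundary F (last F)) ≡ boundary F 0
  boundary-wrap A = refl
  boundary-wrap B rewrite n∸n≡0 (3 + N) = refl
  boundary-wrap C = rot-front-M

  classify : ∀ x → Valid x → Σ Face λ F → Σ ℕ λ s → s ≤ last F × boundary F s ≡ x
  classify (0 , false) _ = A , 0 , ≤-lit , refl
  classify (1 , false) _ = A , 1 , ≤-lit , refl
  classify (2 , false) _ = A , 2 , ≤-lit , refl
  classify (3 , false) _ = A , 3 , ≤-lit , refl
  classify (4 , false) _ = B , 0 , ≤-lit , refl
  classify (5 , false) _ = B , 1 , ≤-lit , refl
  classify (6 , false) _ = B , 2 , ≤-lit , refl
  classify (7 , false) _ = B , 3 , ≤-lit , refl
  classify (suc (suc (suc (suc (suc (suc (suc (suc i))))))) , false) i<m =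
    C , 4 + i , s≤s (s≤s (s≤s (s≤s (≤-pred (pred⁸ i<m))))) , refl
  classify (0 , true) _ = C , 3 , ≤-lit , refl
  classify (1 , true) _ = C , 2 , ≤-lit , refl
  classify (2 , true) _ = C , 1 , ≤-lit , refl
  classify (3 , true) _ = C , 0 , ≤-lit , refl
  classify (4 , true) _ = A , 7 , ≤-lit , refl
  classify (5 , true) _ = A , 6 , ≤-lit , refl
  classify (6 , true) _ = A , 5 , ≤-lit , refl
  classify (7 , true) _ = A , 4 , ≤-lit , refl
  classify (suc (suc (suc (suc (suc (suc (suc (suc i))))))) , true) i<m =
    B , 4 + (3 + N ∸ i) , s≤s (s≤s (s≤s (s≤s (m∸n≤m (3 + N) i)))) ,
    cong (λ j → 8 + j , true) (m∸[m∸n]≡n (≤-pred (pred⁸ i<m)))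

  start : Face → Dart m
  start A = fromℕ< (<m 0) , false
  start B = fromℕ< (<m 4) , false
  start C = fromℕ< (<m 3) , true

  enc-start : ∀ F → enc (start F) ≡ boundary F 0
  enc-start A = refl
  enc-start B = refl
  enc-start C = refl

  enc-boundary : ∀ F k → k ≤ last F → enc (iter φ k (start F)) ≡ boundary F k
  enc-boundary F zero    _         = enc-start F
  enc-boundary F (suc k) 1+k≤last = begin
    enc (φ (iter φ k (start F)))  ≡⟨ enc-φ (iter φ k (start F)) ⟩
    φᶜ (enc (iter φ k (start F))) ≡⟨ cong φᶜ (enc-boundary F k (<⇒≤ 1+k≤last)) ⟩
    φᶜ (boundary F k)             ≡⟨ boundary-step F k 1+k≤last ⟩
    boundary F (suc k)            ∎
    where open ≡-Reasoning

  boundary-closed : ∀ F → iter φ (suc (last F)) (start F) ≡ start F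
  boundary-closed F = enc-injective (begin
    enc (φ (iter φ (last F) (start F)))  ≡⟨ enc-φ (iter φ (last F) (start F)) ⟩
    φᶜ (enc (iter φ (last F) (start F))) ≡⟨ cong φᶜ (enc-boundary F (last F) ≤-refl) ⟩
    φᶜ (boundary F (last F))             ≡⟨ boundary-wrap F ⟩
    boundary F 0                         ≡⟨ enc-start F ⟨
    enc (start F)                        ∎)
    where open ≡-Reasoning

  module Boundary (F : Face) = Periodic φ (start F) (last F) (boundary-closed F)

  on-boundary : ∀ d → Σ Face λ F → Σ ℕ λ s → s ≤ last F × iter φ s (start F) ≡ d
  on-boundary d with classify (enc d) (enc-valid d)
  ... | F , s , s≤last , eq = F , s , s≤last , enc-injective (trans (enc-boundary F s s≤last) eq)

  last<2m : ∀ F → last F < m + m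
  last<2m A = ≤-trans ≤-lit (m≤m+n 12 _)
  last<2m B = ≤-trans (+-monoˡ-≤ N ≤-lit) (m≤m+n m m)
  last<2m C = ≤-trans (+-monoˡ-≤ N ≤-lit) (m≤m+n m m)

  idxᶜ : Code → ℕ
  idxᶜ (i , false) = i
  idxᶜ (i , true)  = m + i

  idx≡idxᶜ : ∀ d → idx d ≡ idxᶜ (enc d)
  idx≡idxᶜ (_ , false) = refl
  idx≡idxᶜ (_ , true)  = refl

  idx-boundary : ∀ F r → r ≤ last F → idx (iter φ r (start F)) ≡ idxᶜ (boundary F r)
  idx-boundary F r r≤last = trans (idx≡idxᶜ (iter φ r (start F))) (cong idxᶜ (enc-boundary F r r≤last))

  m≤idxᶜ : ∀ i → m ≤ idxᶜ (i , true)
  m≤idxᶜ i = m≤m+n m i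

  rep-position : Face → ℕ
  rep-position A = 0
  rep-position B = 0
  rep-position C = 4

  rep≤last : ∀ F → rep-position F ≤ last F
  rep≤last A = z≤n
  rep≤last B = z≤n
  rep≤last C = ≤-lit

  boundary-idx-strict : ∀ F r → r ≤ last F → r ≢ rep-position F →
                        idxᶜ (boundary F (rep-position F)) < idxᶜ (boundary F r)
  boundary-idx-strict A 0 _ r≢0 = ⊥-elim (r≢0 refl)
  boundary-idx-strict A 1 _ _ = ≤-lit
  boundary-idx-strict A 2 _ _ = ≤-lit
  boundary-idx-strict A 3 _ _ = ≤-lit
  boundary-idx-strict A (suc (suc (suc (suc _)))) _ _ = ≤-trans (<m 0) (m≤idxᶜ _)
  boundary-idx-strict B 0 _ r≢0 = ⊥-elim (r≢0 refl)
  boundary-idx-strict B 1 _ _ = ≤-lit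
  boundary-idx-strict B 2 _ _ = ≤-lit
  boundary-idx-strict B 3 _ _ = ≤-lit
  boundary-idx-strict B (suc (suc (suc (suc _)))) _ _ = ≤-trans (<m 4) (m≤idxᶜ _)
  boundary-idx-strict C 0 _ _ = ≤-trans (<m 8) (m≤idxᶜ _)
  boundary-idx-strict C 1 _ _ = ≤-trans (<m 8) (m≤idxᶜ _)
  boundary-idx-strict C 2 _ _ = ≤-trans (<m 8) (m≤idxᶜ _)
  boundary-idx-strict C 3 _ _ = ≤-trans (<m 8) (m≤idxᶜ _)
  boundary-idx-strict C 4 _ r≢4 = ⊥-elim (r≢4 refl)
  boundary-idx-strict C (suc (suc (suc (suc (suc t))))) _ _ = +-monoʳ-≤ 8 (s≤s z≤n)

  boundary-idx-min : ∀ F r → r ≤ last F → idxᶜ (boundary F (rep-position F)) ≤ idxᶜ (boundary F r)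
  boundary-idx-min F r r≤last with r ≟ rep-position F
  ... | yes refl  = ≤-refl
  ... | no  r≢rep = <⇒≤ (boundary-idx-strict F r r≤last r≢rep)

  _≟ᶜ_ : (x y : Code) → Dec (x ≡ y)
  _≟ᶜ_ = ≡-dec _≟_ _≟B_

  IsFaceRep : Code → Set
  IsFaceRep x = x ≡ (0 , false) ⊎ x ≡ (4 , false) ⊎ x ≡ (8 , false)

  isFaceRep? : ∀ x → Dec (IsFaceRep x)
  isFaceRep? x = (x ≟ᶜ (0 , false)) ⊎-dec (x ≟ᶜ (4 , false)) ⊎-dec (x ≟ᶜ (8 , false))

  isFaceRep-boundary : ∀ F → IsFaceRep (boundary F (rep-position F))
  isFaceRep-boundary A = inj₁ refl
  isFaceRep-boundary B = inj₂ (inj₁ refl)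
  isFaceRep-boundary C = inj₂ (inj₂ refl)

  boundary-isFaceRep : ∀ x → IsFaceRep x → Σ Face λ F → boundary F (rep-position F) ≡ x
  boundary-isFaceRep _ (inj₁ refl)        = A , refl
  boundary-isFaceRep _ (inj₂ (inj₁ refl)) = B , refl
  boundary-isFaceRep _ (inj₂ (inj₂ refl)) = C , refl

  isFaceRep⇒isRep : ∀ d → IsFaceRep (enc d) → IsRep φ d
  isFaceRep⇒isRep d rep with boundary-isFaceRep (enc d) rep
  ... | F , eq = isRep-of-closed Θ φ OnBoundary (rep-position F , rep≤last F , d≡rep) closed minimal
    where
    OnBoundary : Dart m → Set
    OnBoundary y = Σ ℕ λ r → r ≤ last F × iter φ r (start F) ≡ y
    d≡rep : iter φ (rep-position F) (start F) ≡ d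
    d≡rep = enc-injective (trans (enc-boundary F _ (rep≤last F)) eq)
    closed : ∀ {y} → OnBoundary y → OnBoundary (φ y)
    closed (r , _ , refl) with Boundary.orbit F (suc r)
    ... | r′ , r′≤last , eq′ = r′ , r′≤last , sym eq′
    minimal : ∀ {y} → OnBoundary y → idx d ≤ idx y
    minimal (r , r≤last , refl) = subst₂ _≤_
      (sym (trans (idx≡idxᶜ d) (cong idxᶜ (sym eq))))
      (sym (idx-boundary F r r≤last))
      (boundary-idx-min F r r≤last)

  isRep⇒isFaceRep : ∀ d → IsRep φ d → IsFaceRep (enc d)
  isRep⇒isFaceRep d rep with on-boundary d
  ... | F , s , s≤last , refl with s ≟ rep-position F
  ...   | yes refl = subst IsFaceRep (sym (enc-boundary F s s≤last)) (isFaceRep-boundary F)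
  ...   | no  s≢rep with Boundary.reach F s≤last (rep≤last F)
  ...     | k , k≤last , eq = ⊥-elim (¬isRep-of-smaller Θ φ k (≤-<-trans k≤last (last<2m F)) smaller rep)
    where
    smaller : idx (iter φ k (iter φ s (start F))) < idx (iter φ s (start F))
    smaller = subst₂ _<_
      (sym (trans (cong idx eq) (idx-boundary F _ (rep≤last F))))
      (sym (idx-boundary F s s≤last))
      (boundary-idx-strict F s s≤last s≢rep)

  high : Fin N → Fin m
  high = 12 ↑ʳ_

  dartsOf : List (Fin m) → List (Dart m)
  dartsOf = concatMap λ e → (e , false) ∷ (e , true) ∷ []

  darts-split : darts m ≡ dartsOf (take 12 (allFin m)) ++ dartsOf (tabulate high)
  darts-split = refl

  filter-high-none : ∀ {n} (g : Fin n → Fin m) {Q : Dart m → Set} (Q? : Decidable Q) →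
                     (∀ i b → ¬ Q (g i , b)) → filter Q? (dartsOf (tabulate g)) ≡ []
  filter-high-none {zero}  g Q? ¬Q = refl
  filter-high-none {suc n} g Q? ¬Q = begin
    filter Q? ((g Fin.zero , false) ∷ (g Fin.zero , true) ∷ dartsOf (tabulate (g ∘ Fin.suc)))
      ≡⟨ filter-reject Q? (¬Q Fin.zero false) ⟩
    filter Q? ((g Fin.zero , true) ∷ dartsOf (tabulate (g ∘ Fin.suc)))
      ≡⟨ filter-reject Q? (¬Q Fin.zero true) ⟩
    filter Q? (dartsOf (tabulate (g ∘ Fin.suc)))
      ≡⟨ filter-high-none (g ∘ Fin.suc) Q? (¬Q ∘ Fin.suc) ⟩
    [] ∎
    where open ≡-Reasoning

  length-filter-high-backs : ∀ {n} (g : Fin n → Fin m) {Q : Dart m → Set} (Q? : Decidable Q) →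
                             (∀ i → Q (g i , false)) → (∀ i → ¬ Q (g i , true)) →
                             length (filter Q? (dartsOf (tabulate g))) ≡ n
  length-filter-high-backs {zero}  g Q? _ _ = refl
  length-filter-high-backs {suc n} g Q? Qf ¬Qt = begin
    length (filter Q? ((g Fin.zero , false) ∷ (g Fin.zero , true) ∷ dartsOf (tabulate (g ∘ Fin.suc))))
      ≡⟨ cong length (filter-accept Q? (Qf Fin.zero)) ⟩
    suc (length (filter Q? ((g Fin.zero , true) ∷ dartsOf (tabulate (g ∘ Fin.suc)))))
      ≡⟨ cong (suc ∘ length) (filter-reject Q? (¬Qt Fin.zero)) ⟩
    suc (length (filter Q? (dartsOf (tabulate (g ∘ Fin.suc)))))
      ≡⟨ cong suc (length-filter-high-backs (g ∘ Fin.suc) Q? (Qf ∘ Fin.suc) (¬Qt ∘ Fin.suc)) ⟩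
    suc n ∎
    where open ≡-Reasoning

  numFaces≡3 : Map.numFaces Θ ≡ 3
  numFaces≡3 = begin
    Map.numFaces Θ
      ≡⟨ numFaces-≐ Θ Q? ((λ {d} → isRep⇒isFaceRep d) , λ {d} → isFaceRep⇒isRep d) ⟩
    length (filter Q? (darts m))
      ≡⟨ cong (length ∘ filter Q?) darts-split ⟩
    length (filter Q? (dartsOf (take 12 (allFin m)) ++ dartsOf (tabulate high)))
      ≡⟨ cong length (filter-++ Q? (dartsOf (take 12 (allFin m))) (dartsOf (tabulate high))) ⟩
    length (filter Q? (dartsOf (take 12 (allFin m))) ++ filter Q? (dartsOf (tabulate high)))
      ≡⟨ cong (λ l → length (filter Q? (dartsOf (take 12 (allFin m))) ++ l)) (filter-high-none high Q? high-not-rep) ⟩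
    3 ∎
    where
    open ≡-Reasoning
    Q? = isFaceRep? ∘ enc
    high-not-rep : ∀ i b → ¬ IsFaceRep (12 + toℕ i , b)
    high-not-rep i b (inj₁ ())
    high-not-rep i b (inj₂ (inj₁ ()))
    high-not-rep i b (inj₂ (inj₂ ()))

  -- Each vertex is represented by its dart of least index: the second pole by (3,t), every
  -- other vertex by its back dart (i,f), except that (4,f) and (8,f) share the first pole with (0,f).
  IsVertexRep : Code → Set
  IsVertexRep x = x ≡ (3 , true) ⊎ (proj₂ x ≡ false × proj₁ x ≢ 4 × proj₁ x ≢ 8)

  isVertexRep? : ∀ x → Dec (IsVertexRep x)
  isVertexRep? x = (x ≟ᶜ (3 , true)) ⊎-dec ((proj₂ x ≟B false) ×-dec ¬? (proj₁ x ≟ 4) ×-dec ¬? (proj₁ x ≟ 8))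

  vertexᶜ : ∀ x → Valid x → IsVertexRep x →
            Σ (Code → Set) λ S → S x × (∀ {y} → S y → S (σᶜ y)) × (∀ {y} → S y → idxᶜ x ≤ idxᶜ y)
  vertexᶜ (_ , false) _ (inj₁ ())
  vertexᶜ (_ , true)  _ (inj₂ (() , _))
  vertexᶜ (zero , false) _ _ = Pole , inj₁ refl , closed , λ _ → z≤n
    where
    Pole : Code → Set
    Pole y = y ≡ (0 , false) ⊎ y ≡ (8 , false) ⊎ y ≡ (4 , false)
    closed : ∀ {y} → Pole y → Pole (σᶜ y)
    closed (inj₁ refl)        = inj₂ (inj₁ refl)
    closed (inj₂ (inj₁ refl)) = inj₂ (inj₂ refl)
    closed (inj₂ (inj₂ refl)) = inj₁ refl
  vertexᶜ (suc i , false) i<m (inj₂ (_ , i≢4 , i≢8)) = Inner , inj₁ refl , closed , minimal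
    where
    Inner : Code → Set
    Inner y = y ≡ (suc i , false) ⊎ y ≡ (i , true)
    closed : ∀ {y} → Inner y → Inner (σᶜ y)
    closed (inj₁ refl) = inj₂ (rot-back-inner i i≢4 i≢8)
    closed (inj₂ refl) = inj₁ (rot-front-inner i (i≢4 ∘ cong suc) (i≢8 ∘ cong suc) (<⇒≢ (≤-pred i<m)))
    minimal : ∀ {y} → Inner y → suc i ≤ idxᶜ y
    minimal (inj₁ refl) = ≤-refl
    minimal (inj₂ refl) = ≤-trans (<⇒≤ i<m) (m≤idxᶜ i)
  vertexᶜ (_ , true) _ (inj₁ refl) = Pole , inj₁ refl , closed , minimal
    where
    Pole : Code → Set
    Pole y = y ≡ (3 , true) ⊎ y ≡ (7 , true) ⊎ y ≡ (M , true)
    closed : ∀ {y} → Pole y → Pole (σᶜ y)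
    closed (inj₁ refl)        = inj₂ (inj₁ refl)
    closed (inj₂ (inj₁ refl)) = inj₂ (inj₂ refl)
    closed (inj₂ (inj₂ refl)) = inj₁ rot-front-M
    minimal : ∀ {y} → Pole y → m + 3 ≤ idxᶜ y
    minimal (inj₁ refl)        = ≤-refl
    minimal (inj₂ (inj₁ refl)) = +-monoʳ-≤ m ≤-lit
    minimal (inj₂ (inj₂ refl)) = +-monoʳ-≤ m ≤-lit

  isVertexRep⇒isRep : ∀ d → IsVertexRep (enc d) → IsRep σ d
  isVertexRep⇒isRep d rep with vertexᶜ (enc d) (enc-valid d) rep
  ... | S , d∈S , closed , minimal = isRep-of-closed Θ σ (S ∘ enc) d∈S
    (λ {y} y∈S → subst S (sym (enc-σ y)) (closed y∈S))
    (λ {y} y∈S → subst₂ _≤_ (sym (idx≡idxᶜ d)) (sym (idx≡idxᶜ y)) (minimal y∈S))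

  ¬isRep-of-smallerᶜ : ∀ d k → {True (k <? 3)} → idxᶜ (iter σᶜ k (enc d)) < idxᶜ (enc d) → ¬ IsRep σ d
  ¬isRep-of-smallerᶜ d k {k<3} smaller = ¬isRep-of-smaller Θ σ k (≤-trans (toWitness k<3) (m≤m+n 3 _))
    (subst₂ _<_ (sym (trans (idx≡idxᶜ (iter σ k d)) (cong idxᶜ (enc-iter-σ k d)))) (sym (idx≡idxᶜ d)) smaller)

  isRep⇒isVertexRep : ∀ d → IsRep σ d → IsVertexRep (enc d)
  isRep⇒isVertexRep d@(e , false) rep with toℕ e ≟ 4 | toℕ e ≟ 8
  ... | no e≢4 | no e≢8 = inj₂ (refl , e≢4 , e≢8)
  ... | yes e≡4 | _     = ⊥-elim (¬isRep-of-smallerᶜ d 1 (subst (λ i → idxᶜ (σᶜ (i , false)) < i) (sym e≡4) ≤-lit) rep)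
  ... | no _    | yes e≡8 = ⊥-elim (¬isRep-of-smallerᶜ d 1 (subst (λ i → idxᶜ (σᶜ (i , false)) < i) (sym e≡8) ≤-lit) rep)
  isRep⇒isVertexRep d@(e , true) rep with toℕ e ≟ 3 | toℕ e ≟ 7 | toℕ e ≟ M
  ... | yes e≡3 | _ | _ = inj₁ (cong (_, true) e≡3)
  ... | no _ | yes e≡7 | _ =
    ⊥-elim (¬isRep-of-smallerᶜ d 2 (subst (λ i → idxᶜ (σᶜ (σᶜ (i , true))) < m + i) (sym e≡7) to-pole) rep)
    where
    to-pole : idxᶜ (σᶜ (rot-front 7)) < m + 7
    to-pole rewrite rot-front-M = +-monoʳ-< m ≤-lit
  ... | no _ | no _ | yes e≡M =
    ⊥-elim (¬isRep-of-smallerᶜ d 1 (subst (λ i → idxᶜ (σᶜ (i , true)) < m + i) (sym e≡M) to-pole) rep)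
    where
    to-pole : idxᶜ (rot-front M) < m + M
    to-pole rewrite rot-front-M = +-monoʳ-< m ≤-lit
  ... | no e≢3 | no e≢7 | no e≢M =
    ⊥-elim (¬isRep-of-smallerᶜ d 1 (subst (_< m + toℕ e) (sym (cong idxᶜ (rot-front-inner (toℕ e) e≢3 e≢7 e≢M)))
                                           (+-monoˡ-≤ (toℕ e) ≤-lit)) rep)

  numVertices≡11+N : Map.numVertices Θ ≡ 11 + N
  numVertices≡11+N = begin
    Map.numVertices Θ
      ≡⟨ numVertices-≐ Θ Q? ((λ {d} → isRep⇒isVertexRep d) , λ {d} → isVertexRep⇒isRep d) ⟩
    length (filter Q? (darts m))
      ≡⟨ cong (length ∘ filter Q?) darts-split ⟩
    length (filter Q? (dartsOf (take 12 (allFin m)) ++ dartsOf (tabulate high)))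
      ≡⟨ cong length (filter-++ Q? (dartsOf (take 12 (allFin m))) (dartsOf (tabulate high))) ⟩
    length (filter Q? (dartsOf (take 12 (allFin m))) ++ filter Q? (dartsOf (tabulate high)))
      ≡⟨ length-++ (filter Q? (dartsOf (take 12 (allFin m)))) {filter Q? (dartsOf (tabulate high))} ⟩
    11 + length (filter Q? (dartsOf (tabulate high)))
      ≡⟨ cong (11 +_) (length-filter-high-backs high Q? (λ i → inj₂ (refl , (λ ()) , (λ ())))
                                                      (λ { i (inj₁ ()) ; i (inj₂ (() , _)) })) ⟩
    11 + N ∎
    where
    open ≡-Reasoning
    Q? = isVertexRep? ∘ enc

  euler : Map.numVertices Θ + Map.numFaces Θ ≡ m + 2
  euler = trans (cong₂ _+_ numVertices≡11+N numFaces≡3) (cong (11 +_) (+-suc N 2))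

  position : Face → ℕ → ℕ
  position A 4 = 7
  position A 5 = 6
  position A 6 = 5
  position A 7 = 4
  position A i = i
  position B 4 = 0
  position B 5 = 1
  position B 6 = 2
  position B 7 = 3
  position B (suc (suc (suc (suc (suc (suc (suc (suc i)))))))) = 4 + (3 + N ∸ i)
  position B _ = 0
  position C 0 = 3
  position C 1 = 2
  position C 2 = 1
  position C 3 = 0
  position C (suc (suc (suc (suc (suc (suc (suc (suc i)))))))) = 4 + i
  position C _ = 0

  position-boundary : ∀ F k → k ≤ last F → position F (proj₁ (boundary F k)) ≡ k
  position-boundary A 0 _ = refl
  position-boundary A 1 _ = refl
  position-boundary A 2 _ = refl
  position-boundary A 3 _ = refl
  position-boundary A 4 _ = refl
  position-boundary A 5 _ = refl
  position-boundary A 6 _ = refl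
  position-boundary A 7 _ = refl
  position-boundary A (suc (suc (suc (suc (suc (suc (suc (suc _)))))))) (s≤s (s≤s (s≤s (s≤s (s≤s (s≤s (s≤s ())))))))
  position-boundary B 0 _ = refl
  position-boundary B 1 _ = refl
  position-boundary B 2 _ = refl
  position-boundary B 3 _ = refl
  position-boundary B (suc (suc (suc (suc t)))) (s≤s (s≤s (s≤s (s≤s t≤3+N)))) = cong (4 +_) (m∸[m∸n]≡n t≤3+N)
  position-boundary C 0 _ = refl
  position-boundary C 1 _ = refl
  position-boundary C 2 _ = refl
  position-boundary C 3 _ = refl
  position-boundary C (suc (suc (suc (suc t)))) _ = refl

  OnFace : Face → ℕ → Set
  OnFace A i = i < 8
  OnFace B i = 4 ≤ i
  OnFace C i = i < 4 ⊎ 8 ≤ i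

  onFace? : ∀ F i → Dec (OnFace F i)
  onFace? A i = i <? 8
  onFace? B i = 4 ≤? i
  onFace? C i = (i <? 4) ⊎-dec (8 ≤? i)

  onFace-boundary : ∀ F r → r ≤ last F → OnFace F (proj₁ (boundary F r))
  onFace-boundary A 0 _ = ≤-lit
  onFace-boundary A 1 _ = ≤-lit
  onFace-boundary A 2 _ = ≤-lit
  onFace-boundary A 3 _ = ≤-lit
  onFace-boundary A (suc (suc (suc (suc t)))) _ = s≤s (m∸n≤m 7 t)
  onFace-boundary B 0 _ = ≤-lit
  onFace-boundary B 1 _ = ≤-lit
  onFace-boundary B 2 _ = ≤-lit
  onFace-boundary B 3 _ = ≤-lit
  onFace-boundary B (suc (suc (suc (suc t)))) _ = ≤-trans ≤-lit (m≤m+n 8 _)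
  onFace-boundary C 0 _ = inj₁ ≤-lit
  onFace-boundary C 1 _ = inj₁ ≤-lit
  onFace-boundary C 2 _ = inj₁ ≤-lit
  onFace-boundary C 3 _ = inj₁ ≤-lit
  onFace-boundary C (suc (suc (suc (suc t)))) _ = inj₂ (m≤m+n 8 t)

  boundary-position : ∀ F i → i < m → OnFace F i → position F i ≤ last F × proj₁ (boundary F (position F i)) ≡ i
  boundary-position A 0 _ _ = ≤-lit , refl
  boundary-position A 1 _ _ = ≤-lit , refl
  boundary-position A 2 _ _ = ≤-lit , refl
  boundary-position A 3 _ _ = ≤-lit , refl
  boundary-position A 4 _ _ = ≤-lit , refl
  boundary-position A 5 _ _ = ≤-lit , refl
  boundary-position A 6 _ _ = ≤-lit , refl
  boundary-position A 7 _ _ = ≤-lit , refl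
  boundary-position A (suc (suc (suc (suc (suc (suc (suc (suc _)))))))) _ (s≤s (s≤s (s≤s (s≤s (s≤s (s≤s (s≤s (s≤s ()))))))))
  boundary-position B 4 _ _ = ≤-lit , refl
  boundary-position B 5 _ _ = ≤-lit , refl
  boundary-position B 6 _ _ = ≤-lit , refl
  boundary-position B 7 _ _ = ≤-lit , refl
  boundary-position B (suc (suc (suc (suc (suc (suc (suc (suc i)))))))) i<m _ =
    s≤s (s≤s (s≤s (s≤s (m∸n≤m (3 + N) i)))) , cong (8 +_) (m∸[m∸n]≡n (≤-pred (pred⁸ i<m)))
  boundary-position C 0 _ _ = ≤-lit , refl
  boundary-position C 1 _ _ = ≤-lit , refl
  boundary-position C 2 _ _ = ≤-lit , refl
  boundary-position C 3 _ _ = ≤-lit , refl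
  boundary-position C (suc (suc (suc (suc (suc (suc (suc (suc i)))))))) i<m _ =
    s≤s (s≤s (s≤s (s≤s (≤-pred (pred⁸ i<m))))) , refl
  boundary-position B 0 _ ()
  boundary-position B 1 _ (s≤s ())
  boundary-position B 2 _ (s≤s (s≤s ()))
  boundary-position B 3 _ (s≤s (s≤s (s≤s ())))
  boundary-position C 4 _ (inj₁ (s≤s (s≤s (s≤s (s≤s ())))))
  boundary-position C 5 _ (inj₁ (s≤s (s≤s (s≤s (s≤s ())))))
  boundary-position C 6 _ (inj₁ (s≤s (s≤s (s≤s (s≤s ())))))
  boundary-position C 7 _ (inj₁ (s≤s (s≤s (s≤s (s≤s ())))))
  boundary-position C 4 _ (inj₂ (s≤s (s≤s (s≤s (s≤s ())))))
  boundary-position C 5 _ (inj₂ (s≤s (s≤s (s≤s (s≤s (s≤s ()))))))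
  boundary-position C 6 _ (inj₂ (s≤s (s≤s (s≤s (s≤s (s≤s (s≤s ())))))))
  boundary-position C 7 _ (inj₂ (s≤s (s≤s (s≤s (s≤s (s≤s (s≤s (s≤s ()))))))))

  onFace-along : ∀ F s k {e b} → s ≤ last F → iter φ k (iter φ s (start F)) ≡ (e , b) → OnFace F (toℕ e)
  onFace-along F s k s≤last eq with Boundary.orbit-from F k s
  ... | r , r≤last , eq′ = subst (OnFace F)
    (cong proj₁ (trans (sym (enc-boundary F r r≤last)) (cong enc (trans (sym eq′) eq))))
    (onFace-boundary F r r≤last)

  incident⇒onFace : ∀ F s → s ≤ last F → ∀ {e} → IncidentFace (iter φ s (start F)) e → OnFace F (toℕ e)
  incident⇒onFace F s s≤last (inj₁ (k , eq)) = onFace-along F s (toℕ k) s≤last eq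
  incident⇒onFace F s s≤last (inj₂ (k , eq)) = onFace-along F s (toℕ k) s≤last eq

  onFace⇒incident : ∀ F s → s ≤ last F → ∀ {e} → OnFace F (toℕ e) → IncidentFace (iter φ s (start F)) e
  onFace⇒incident F s s≤last {e} on with boundary-position F (toℕ e) (toℕ<n e) on
  ... | r≤last , edge≡e with Boundary.reach F s≤last r≤last
  ... | k , k≤last , eq = incident-at Θ (proj₂ (boundary F r)) kF (enc-injective (begin
    enc (iter φ (toℕ kF) (iter φ s (start F))) ≡⟨ cong (λ j → enc (iter φ j (iter φ s (start F)))) (toℕ-fromℕ< k<2m) ⟩
    enc (iter φ k (iter φ s (start F)))        ≡⟨ cong enc eq ⟩
    enc (iter φ r (start F))                   ≡⟨ enc-boundary F r r≤last ⟩
    boundary F r                               ≡⟨ cong (_, proj₂ (boundary F r)) edge≡e ⟩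
    (toℕ e , proj₂ (boundary F r))             ∎))
    where
    open ≡-Reasoning
    r = position F (toℕ e)
    k<2m = ≤-<-trans k≤last (last<2m F)
    kF = fromℕ< k<2m

  faceColours : (Fin m → ℕ) → Face → List ℕ
  faceColours col F = map col (filter (onFace? F ∘ toℕ) (allFin m))

  -- The dart is kept abstract here: stating this for iter φ s (start F) itself makes Agda
  -- evaluate the incidence decisions hidden in countColor.
  countColor-face : ∀ col F s c {d} → s ≤ last F → iter φ s (start F) ≡ d →
                    Map.countColor Θ col d c ≡ count c (faceColours col F)
  countColor-face col F s c {d} s≤last eq =
    trans (countColor-≐ Θ col d c (onFace? F ∘ toℕ) (incident⇒ , incident⇐))
          (count-filter-map (onFace? F ∘ toℕ) col c (allFin m))
    where
    incident⇒ : ∀ {e} → IncidentFace d e → OnFace F (toℕ e)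
    incident⇒ {e} = incident⇒onFace F s s≤last ∘ subst (λ x → IncidentFace x e) (sym eq)
    incident⇐ : ∀ {e} → OnFace F (toℕ e) → IncidentFace d e
    incident⇐ {e} = subst (λ x → IncidentFace x e) eq ∘ onFace⇒incident F s s≤last

  open Reversible Θ 5 σ-order using (walk-reverse; module FaceCycle)

  edge-injective : ∀ F {k k′} → k ≤ last F → k′ ≤ last F →
                   edge (iter φ k (start F)) ≡ edge (iter φ k′ (start F)) → k ≡ k′
  edge-injective F {k} {k′} k≤last k′≤last eq = begin
    k                                    ≡⟨ position-boundary F k k≤last ⟨
    position F (proj₁ (boundary F k))    ≡⟨ cong (position F) same-edge ⟩
    position F (proj₁ (boundary F k′))   ≡⟨ position-boundary F k′ k′≤last ⟩
    k′                                   ∎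
    where
    open ≡-Reasoning
    same-edge : proj₁ (boundary F k) ≡ proj₁ (boundary F k′)
    same-edge = trans (cong proj₁ (sym (enc-boundary F k k≤last)))
                      (trans (cong toℕ eq) (cong proj₁ (enc-boundary F k′ k′≤last)))

  module BoundaryWalk (F : Face) = FaceCycle (start F) (last F) (boundary-closed F) (edge-injective F)

  start-to-root : ∀ F e → Walk Θ (_≢ e) (start F) (start A)
  start-to-root A e = ε
  start-to-root B e = around (start B) ◅ ε
  start-to-root C e = around (start C) ◅ subst (λ d → Walk Θ (_≢ e) d (start A)) σ-startC
                                                 (BoundaryWalk.walk-to-start A e 4 ≤-lit)
    where
    σ-startC : iter φ 4 (start A) ≡ σ (start C)
    σ-startC = enc-injective (enc-boundary A 4 ≤-lit)

  walk-to-root : ∀ e d → Walk Θ (_≢ e) d (start A)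
  walk-to-root e d with on-boundary d
  ... | F , s , s≤last , refl = BoundaryWalk.walk-to-start F e s s≤last ◅◅ start-to-root F e

  two-edge-connected : Map.TwoEdgeConnected Θ
  two-edge-connected = connected , connected-without
    where
    connected-without : ∀ e → Map.ConnectedWithout Θ e
    connected-without e d d′ = walk-to-root e d ◅◅ walk-reverse (walk-to-root e d′)
    connected : Map.Connected Θ
    connected d d′ = walk-weaken Θ (λ _ → tt) (connected-without Fin.zero d d′)

  plane : Map.IsPlane Θ
  plane = proj₁ two-edge-connected , euler

  φ-back-inner : ∀ e {e′} → 8 ≤ toℕ e → toℕ e′ ≡ suc (toℕ e) → edge (φ (e , false)) ≡ e′
  φ-back-inner e {e′} 8≤e e′≡1+e = toℕ-injective (begin
    toℕ (edge (φ (e , false)))  ≡⟨ cong proj₁ (enc-φ (e , false)) ⟩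
    proj₁ (rot-front (toℕ e))   ≡⟨ cong proj₁ (rot-front-inner (toℕ e) (below 3) (below 7) e≢M) ⟩
    suc (toℕ e)                 ≡⟨ e′≡1+e ⟨
    toℕ e′                      ∎)
    where
    open ≡-Reasoning
    below : ∀ k → {True (k <? 8)} → toℕ e ≢ k
    below k {k<8} e≡k = <⇒≱ (toWitness k<8) (subst (8 ≤_) e≡k 8≤e)
    e≢M : toℕ e ≢ M
    e≢M e≡M = <-irrefl (trans e′≡1+e (cong suc e≡M)) (toℕ<n e′)

  path₁ path₂ path₃ : List (Fin m)
  path₁ = take 4 (allFin m)
  path₂ = take 4 (drop 4 (allFin m))
  path₃ = drop 8 (allFin m)

  8≤high : ∀ i → 8 ≤ toℕ (high i)
  8≤high i = ≤-trans ≤-lit (m≤m+n 12 (toℕ i))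

  edges-A : filter (onFace? A ∘ toℕ) (allFin m) ≡ path₁ ++ path₂
  edges-A = begin
    filter P? (take 12 (allFin m) ++ tabulate high)  ≡⟨ filter-++ P? (take 12 (allFin m)) (tabulate high) ⟩
    path₁ ++ path₂ ++ filter P? (tabulate high)      ≡⟨ cong ((path₁ ++ path₂) ++_) (filter-none P? high∉A) ⟩
    (path₁ ++ path₂) ++ []                           ≡⟨ ++-identityʳ (path₁ ++ path₂) ⟩
    path₁ ++ path₂                                   ∎
    where
    open ≡-Reasoning
    P? = onFace? A ∘ toℕ
    high∉A = AllP.tabulate⁺ {f = high} λ i lt → <⇒≱ lt (8≤high i)

  edges-B : filter (onFace? B ∘ toℕ) (allFin m) ≡ path₂ ++ path₃
  edges-B = begin
    filter P? (take 12 (allFin m) ++ tabulate high)             ≡⟨ filter-++ P? (take 12 (allFin m)) (tabulate high) ⟩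
    filter P? (take 12 (allFin m)) ++ filter P? (tabulate high) ≡⟨ cong (filter P? (take 12 (allFin m)) ++_) (filter-all P? high∈B) ⟩
    path₂ ++ path₃                                              ∎
    where
    open ≡-Reasoning
    P? = onFace? B ∘ toℕ
    high∈B = AllP.tabulate⁺ {f = high} λ i → ≤-trans ≤-lit (8≤high i)

  edges-C : filter (onFace? C ∘ toℕ) (allFin m) ≡ path₁ ++ path₃
  edges-C = begin
    filter P? (take 12 (allFin m) ++ tabulate high)             ≡⟨ filter-++ P? (take 12 (allFin m)) (tabulate high) ⟩
    filter P? (take 12 (allFin m)) ++ filter P? (tabulate high) ≡⟨ cong (filter P? (take 12 (allFin m)) ++_) (filter-all P? high∈C) ⟩
    path₁ ++ path₃                                              ∎
    where
    open ≡-Reasoning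
    P? = onFace? C ∘ toℕ
    high∈C = AllP.tabulate⁺ {f = high} λ i → inj₂ (8≤high i)

  faceColours-A : ∀ col → faceColours col A ≡ map col path₁ ++ map col path₂
  faceColours-A col = trans (cong (map col) edges-A) (map-++ col path₁ path₂)

  faceColours-B : ∀ col → faceColours col B ≡ map col path₂ ++ map col path₃
  faceColours-B col = trans (cong (map col) edges-B) (map-++ col path₂ path₃)

  faceColours-C : ∀ col → faceColours col C ≡ map col path₁ ++ map col path₃
  faceColours-C col = trans (cong (map col) edges-C) (map-++ col path₁ path₃)

  linked-from : ∀ col → Map.FaciallyProper Θ col → ∀ {n} x (g : Fin n → Fin m) → 8 ≤ toℕ x →
                (∀ i → toℕ (g i) ≡ suc (toℕ x + toℕ i)) → Linked _≢_ (map col (x ∷ tabulate g))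
  linked-from col proper {zero}  x g _   _ = [-]
  linked-from col proper {suc n} x g 8≤x g-next =
    subst (λ y → col x ≢ col y) (φ-back-inner x 8≤x g0≡1+x) (proper (x , false))
    ∷ linked-from col proper (g Fin.zero) (g ∘ Fin.suc) (≤-trans 8≤x (≤-trans (n≤1+n _) (≤-reflexive (sym g0≡1+x))))
        (λ i → trans (g-next (Fin.suc i)) (cong suc (trans (+-suc (toℕ x) (toℕ i)) (cong (_+ toℕ i) (sym g0≡1+x)))))
    where
    g0≡1+x : toℕ (g Fin.zero) ≡ suc (toℕ x)
    g0≡1+x = trans (g-next Fin.zero) (cong suc (+-identityʳ (toℕ x)))

  linked-paths : ∀ col → Map.FaciallyProper Θ col →
                 Linked _≢_ (map col path₁) × Linked _≢_ (map col path₂) × Linked _≢_ (map col path₃)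
  linked-paths col proper =
    (proper (_ , false) ∷ proper (_ , false) ∷ proper (_ , false) ∷ [-]) ,
    (proper (_ , false) ∷ proper (_ , false) ∷ proper (_ , false) ∷ [-]) ,
    linked-from col proper (8 ↑ʳ Fin.zero) (9 ↑ʳ_) ≤-lit (λ i → refl)

  parityList-faceColours : ∀ col → Map.FacialParity Θ col → ∀ F → ParityList (faceColours col F)
  parityList-faceColours col fp F c = facialParity⇒zeroOrOdd Θ col (start F) c fp (countColor-face col F 0 c {start F} z≤n refl)

  12≤numColors : ∀ j → N ≡ j * 4 → ∀ col → Map.FacialParity Θ col → 12 ≤ Map.numColors Θ col
  12≤numColors j N≡j*4 col fp = twelve⇒numColors (twelve-colours 0 0 j refl refl |w|
    (proj₁ linked) (proj₁ (proj₂ linked)) (proj₂ (proj₂ linked))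
    (subst ParityList (faceColours-A col) (parityList-faceColours col fp A))
    (subst ParityList (faceColours-B col) (parityList-faceColours col fp B))
    (parityList-++-comm u w (subst ParityList (faceColours-C col) (parityList-faceColours col fp C))))
    where
    u v w : List ℕ
    u = map col path₁
    v = map col path₂
    w = map col path₃
    linked = linked-paths col (proj₁ fp)
    |w| : length w ≡ suc j * 4
    |w| = trans (length-map col path₃) (trans (length-tabulate (8 ↑ʳ_)) (cong (4 +_) N≡j*4))
    uvw≡colours : u ++ v ++ w ≡ map col (allFin m)
    uvw≡colours = sym (trans (map-++ col path₁ (path₂ ++ path₃)) (cong (u ++_) (map-++ col path₂ path₃)))
    twelve⇒numColors : (Σ (List ℕ) λ L → length L ≡ 12 × Unique L × L ⊆ u ++ v ++ w) → 12 ≤ Map.numColors Θ col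
    twelve⇒numColors (L , |L|≡12 , unique , L⊆uvw) =
      subst (_≤ Map.numColors Θ col) |L|≡12 (numColors≥ Θ col unique (subst (L ⊆_) uvw≡colours L⊆uvw))

  alternate : ℕ → ℕ
  alternate 0 = 8
  alternate 1 = 9
  alternate (suc (suc k)) = alternate k

  colour : ℕ → ℕ
  colour 0 = 0
  colour 1 = 1
  colour 2 = 2
  colour 3 = 3
  colour 4 = 4
  colour 5 = 5
  colour 6 = 6
  colour 7 = 7
  colour 8 = 8
  colour 9 = 9
  colour 10 = 10
  colour 11 = 11
  colour (suc (suc (suc (suc (suc (suc (suc (suc (suc (suc (suc (suc k)))))))))))) = alternate k

  alternate-adjacent : ∀ k → alternate k ≢ alternate (suc k)
  alternate-adjacent 0 ()
  alternate-adjacent 1 ()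
  alternate-adjacent (suc (suc k)) = alternate-adjacent k

  alternate-8⊎9 : ∀ k → alternate k ≡ 8 ⊎ alternate k ≡ 9
  alternate-8⊎9 0 = inj₁ refl
  alternate-8⊎9 1 = inj₂ refl
  alternate-8⊎9 (suc (suc k)) = alternate-8⊎9 k

  colour-adjacent : ∀ i → i ≢ 3 → i ≢ 7 → colour i ≢ colour (suc i)
  colour-adjacent 0 _ _ ()
  colour-adjacent 1 _ _ ()
  colour-adjacent 2 _ _ ()
  colour-adjacent 3 i≢3 _ = ⊥-elim (i≢3 refl)
  colour-adjacent 4 _ _ ()
  colour-adjacent 5 _ _ ()
  colour-adjacent 6 _ _ ()
  colour-adjacent 7 _ i≢7 = ⊥-elim (i≢7 refl)
  colour-adjacent 8 _ _ ()
  colour-adjacent 9 _ _ ()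
  colour-adjacent 10 _ _ ()
  colour-adjacent 11 _ _ ()
  colour-adjacent (suc (suc (suc (suc (suc (suc (suc (suc (suc (suc (suc (suc k)))))))))))) _ _ = alternate-adjacent k

  colour-bounds : ∀ k → 8 ≤ colour (8 + k) × colour (8 + k) < 12
  colour-bounds 0 = ≤-lit , ≤-lit
  colour-bounds 1 = ≤-lit , ≤-lit
  colour-bounds 2 = ≤-lit , ≤-lit
  colour-bounds 3 = ≤-lit , ≤-lit
  colour-bounds (suc (suc (suc (suc k)))) with alternate-8⊎9 k
  ... | inj₁ eq = subst (λ c → 8 ≤ c × c < 12) (sym eq) (≤-lit , ≤-lit)
  ... | inj₂ eq = subst (λ c → 8 ≤ c × c < 12) (sym eq) (≤-lit , ≤-lit)


  colour<12 : ∀ i → colour i < 12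
  colour<12 0 = ≤-lit
  colour<12 1 = ≤-lit
  colour<12 2 = ≤-lit
  colour<12 3 = ≤-lit
  colour<12 4 = ≤-lit
  colour<12 5 = ≤-lit
  colour<12 6 = ≤-lit
  colour<12 7 = ≤-lit
  colour<12 (suc (suc (suc (suc (suc (suc (suc (suc k)))))))) = proj₂ (colour-bounds k)

  colour-proper : ∀ x → Valid x → colour (proj₁ x) ≢ colour (proj₁ (φᶜ x))
  colour-proper (i , false) i<m with i ≟ 3 | i ≟ 7 | i ≟ M
  ... | yes refl | _        | _        = λ ()
  ... | no _     | yes refl | _        = λ eq → <⇒≱ ≤-lit (subst (8 ≤_) (sym eq) (proj₁ (colour-bounds (3 + N))))
  ... | no _     | no _     | yes refl rewrite rot-front-M = λ eq → <⇒≱ ≤-lit (subst (8 ≤_) eq (proj₁ (colour-bounds (3 + N))))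
  ... | no i≢3   | no i≢7   | no i≢M   rewrite rot-front-inner i i≢3 i≢7 i≢M = colour-adjacent i i≢3 i≢7
  colour-proper (zero , true) _ = λ ()
  colour-proper (suc i , true) i<m with suc i ≟ 4 | suc i ≟ 8
  ... | yes refl | _        = λ ()
  ... | no _     | yes refl = λ ()
  ... | no i≢4   | no i≢8   rewrite rot-back-inner i i≢4 i≢8 =
    colour-adjacent i (i≢4 ∘ cong suc) (i≢8 ∘ cong suc) ∘ sym

  col₀ : Fin m → ℕ
  col₀ = colour ∘ toℕ

  proper₀ : Map.FaciallyProper Θ col₀
  proper₀ d eq = colour-proper (enc d) (enc-valid d) (trans eq (cong (colour ∘ proj₁) (enc-φ d)))

  alternation : ℕ → List ℕ
  alternation n = tabulate {n = n} (alternate ∘ toℕ)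

  count-alternation-8 : ∀ i → count 8 (alternation (i * 4)) ≡ i * 2
  count-alternation-8 zero    = refl
  count-alternation-8 (suc i) = cong (2 +_) (count-alternation-8 i)

  count-alternation-9 : ∀ i → count 9 (alternation (i * 4)) ≡ i * 2
  count-alternation-9 zero    = refl
  count-alternation-9 (suc i) = cong (2 +_) (count-alternation-9 i)

  count-alternation-other : ∀ n c → c ≢ 8 → c ≢ 9 → count c (alternation n) ≡ 0
  count-alternation-other n c c≢8 c≢9 = ∉⇒count≡0 {xs = alternation n} λ c∈ → case (∈-tabulate⁻ c∈)
    where
    case : (∃ λ (k : Fin n) → c ≡ alternate (toℕ k)) → ⊥
    case (k , c≡) = [ c≢8 ∘ trans c≡ , c≢9 ∘ trans c≡ ]′ (alternate-8⊎9 (toℕ k))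

  parityList-alternation : ∀ i P → Unique P → count 8 P ≡ 1 → count 9 P ≡ 1 →
                           ParityList (P ++ alternation (i * 4))
  parityList-alternation i P unique c8 c9 c =
    subst ZeroOrOdd (sym (count-++ c P (alternation (i * 4)))) (split (c ≟ 8) (c ≟ 9))
    where
    odd : ∀ {x y} → x ≡ 1 → y ≡ i * 2 → ZeroOrOdd (x + y)
    odd refl refl = inj₂ ([m+kn]%n≡m%n 1 i 2)
    split : Dec (c ≡ 8) → Dec (c ≡ 9) → ZeroOrOdd (count c P + count c (alternation (i * 4)))
    split (yes refl) _          = odd c8 (count-alternation-8 i)
    split (no _)     (yes refl) = odd c9 (count-alternation-9 i)
    split (no c≢8)   (no c≢9)   = subst ZeroOrOdd
      (sym (trans (cong (count c P +_) (count-alternation-other (i * 4) c c≢8 c≢9)) (+-identityʳ _)))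
      (unique⇒parityList unique c)

  unique-lit : ∀ P {u : True (unique? P)} → Unique P
  unique-lit P {u} = toWitness u

  parityList-++-colours₀ : ∀ j → N ≡ j * 4 → ∀ P → Unique P → count 8 P ≡ 1 → count 9 P ≡ 1 →
                           ParityList (P ++ map col₀ (tabulate high))
  parityList-++-colours₀ j N≡j*4 P unique c8 c9 = subst (λ T → ParityList (P ++ T)) (sym (map-tabulate high col₀))
    (subst (λ n → ParityList (P ++ alternation n)) (sym N≡j*4) (parityList-alternation j P unique c8 c9))

  parityList-faceColours₀ : ∀ j → N ≡ j * 4 → ∀ F → ParityList (faceColours col₀ F)
  parityList-faceColours₀ j N≡j*4 A = subst ParityList (sym (faceColours-A col₀))
    (unique⇒parityList (unique-lit (0 ∷ 1 ∷ 2 ∷ 3 ∷ 4 ∷ 5 ∷ 6 ∷ 7 ∷ [])))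
  parityList-faceColours₀ j N≡j*4 B = subst ParityList (sym (faceColours-B col₀))
    (parityList-++-colours₀ j N≡j*4 (4 ∷ 5 ∷ 6 ∷ 7 ∷ 8 ∷ 9 ∷ 10 ∷ 11 ∷ []) (unique-lit _) refl refl)
  parityList-faceColours₀ j N≡j*4 C = subst ParityList (sym (faceColours-C col₀))
    (parityList-++-colours₀ j N≡j*4 (0 ∷ 1 ∷ 2 ∷ 3 ∷ 8 ∷ 9 ∷ 10 ∷ 11 ∷ []) (unique-lit _) refl refl)

  facialParity₀ : ∀ j → N ≡ j * 4 → Map.FacialParity Θ col₀
  facialParity₀ j N≡j*4 = proper₀ , parity-at
    where
    parity-at : ∀ d c → Map.ZeroOrOdd Θ (Map.countColor Θ col₀ d c)
    parity-at d c = at (on-boundary d)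
      where
      at : (Σ Face λ F → Σ ℕ λ s → s ≤ last F × iter φ s (start F) ≡ d) →
           Map.ZeroOrOdd Θ (Map.countColor Θ col₀ d c)
      at (F , s , s≤last , eq) = zeroOrOdd-countColor Θ col₀ d c (countColor-face col₀ F s c {d} s≤last eq)
                                                     (parityList-faceColours₀ j N≡j*4 F c)

  χfp≡12 : ∀ j → N ≡ j * 4 → Map.χfp≡ Θ 12
  χfp≡12 j N≡j*4 =
    (col₀ , facialParity₀ j N≡j*4 ,
      ≤-antisym (numColors≤ Θ col₀ (colour<12 ∘ toℕ)) (12≤numColors j N≡j*4 col₀ (facialParity₀ j N≡j*4))) ,
    12≤numColors j N≡j*4

edges≡4k : ∀ j → 12 + j * 4 ≡ 4 * (3 + j)
edges≡4k = solve-∀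

theorem1 : (k : ℕ) → 3 ≤ k →
    Σ (Map (4 * k)) λ G → Map.IsPlane G × Map.TwoEdgeConnected G × Map.χfp≡ G 12
theorem1 (suc (suc (suc j))) (s≤s (s≤s (s≤s _))) =
  subst (λ n → Σ (Map n) λ G → Map.IsPlane G × Map.TwoEdgeConnected G × Map.χfp≡ G 12) (edges≡4k j)
        (Θ , plane , two-edge-connected , χfp≡12 j refl)
  where open Theta (j * 4)
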